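{- Let $k\ge 2$ and let $A=\{a_1,a_2,\dots,a_k\}$ be positive integers with $\gcd(a_1,\dots,a_k)=1$. For $1\le i\le a_1-1$ let $m_i$ be the least positive integer with $m_i\equiv i\pmod{a_1}$ and $m_i\in{\rm R}(A)$, and set $m_0=0$. Let $\lambda$ be a complex number with $\lambda\ne 0$ and $\lambda^{a_1}\ne 1$, and let $\mu$ be a positive integer. Then \begin{align*} \sum_{n\in{\rm NR}(A)}\lambda^n n^\mu&=\sum_{n=0}^\mu\frac{(-a_1)^n}{(\lambda^{a_1}-1)^{n+1}}\binom{\mu}{n}\sum_{j=0}^n\left\langle {n\atop n-j}\right\rangle\lambda^{j a_1}\sum_{i=0}^{a_1-1}m_i^{\mu-n}\lambda^{m_i}\\ &\quad +\frac{(-1)^{\mu+1}}{(\lambda-1)^{\mu+1}}\sum_{j=0}^\mu\left\langle {\mu\atop \mu-j}\right\rangle\lambda^j . \end{align*}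
   Context: ${\rm R}(A)$ denotes the set of positive integers that can be written as $x_1a_1+\dots+x_ka_k$ with nonnegative integers $x_1,\dots,x_k$, and ${\rm NR}(A)$ denotes the (finite) set of positive integers not in ${\rm R}(A)$. The Eulerian number $\left\langle {n\atop l}\right\rangle$ is the number of permutations of $1,2,\dots,n$ in which exactly $l$ elements are greater than the previous element; in particular $\left\langle {0\atop 0}\right\rangle=1$ and $\left\langle {n\atop n}\right\rangle=0$ for $n\ge1$. The convention $0^0=1$ is used (so $m_0^{0}=1$). -}

module Defs where

open import Level using (Level)
open import Data.Nat using (ℕ; zero; suc; _<_; _<ᵇ_; _≡ᵇ_)
import Data.Nat as ℕ
open import Data.Nat.GCD using (gcd)
open import Data.Bool using (Bool; true; false; if_then_else_)
open import Data.List using (List; []; _∷_; map; concatMap; length; filterᵇ; foldr; upTo)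
open import Data.Vec using (Vec; []; _∷_)
open import Data.Product using (Σ; ∃; _×_)
open import Relation.Binary.PropositionalEquality using (_≡_)
open import Relation.Nullary using (¬_)
open import Algebra.Bundles using (CommutativeRing)

dot : ∀ {k} → Vec ℕ k → Vec ℕ k → ℕ
dot []       []       = 0
dot (x ∷ xs) (a ∷ as) = x ℕ.* a ℕ.+ dot xs as

InR : ∀ {k} → Vec ℕ k → ℕ → Set
InR {k} A n = 0 < n × ∃ λ (x : Vec ℕ k) → n ≡ dot x A

InNR : ∀ {k} → Vec ℕ k → ℕ → Set
InNR A n = 0 < n × ¬ InR A n

gcdVec : ∀ {k} → Vec ℕ k → ℕ
gcdVec []       = 0
gcdVec (a ∷ as) = gcd a (gcdVec as)

first : ∀ {k} → Vec ℕ k → ℕ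
first []      = 0
first (a ∷ _) = a

-- Eulerian numbers, defined as in the paper: the number of permutations
-- of 1,2,…,n with exactly l ascents (elements greater than the previous).

inserts : ℕ → List ℕ → List (List ℕ)
inserts x []       = (x ∷ []) ∷ []
inserts x (y ∷ ys) = (x ∷ y ∷ ys) ∷ map (y ∷_) (inserts x ys)

perms : List ℕ → List (List ℕ)
perms []       = [] ∷ []
perms (x ∷ xs) = concatMap (inserts x) (perms xs)

ascents : List ℕ → ℕ
ascents []           = 0
ascents (x ∷ [])     = 0
ascents (x ∷ y ∷ ys) = (if x <ᵇ y then 1 else 0) ℕ.+ ascents (y ∷ ys)

oneTo : ℕ → List ℕ
oneTo n = map suc (upTo n)

eulerian : ℕ → ℕ → ℕ
eulerian n l = length (filterᵇ (λ p → ascents p ≡ᵇ l) (perms (oneTo n)))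

module RingOps {c ℓ : Level} (R : CommutativeRing c ℓ) where
  open CommutativeRing R

  fromℕ : ℕ → Carrier
  fromℕ zero    = 0#
  fromℕ (suc n) = 1# + fromℕ n

  pow : Carrier → ℕ → Carrier
  pow x zero    = 1#
  pow x (suc n) = x * pow x n

  sumTo : ℕ → (ℕ → Carrier) → Carrier
  sumTo zero    f = f 0
  sumTo (suc n) f = sumTo n f + f (suc n)

  sumList : List ℕ → (ℕ → Carrier) → Carrier
  sumList L f = foldr (λ x acc → f x + acc) 0# L

  IsField : Set (c Level.⊔ ℓ)
  IsField = ¬ (1# ≈ 0#) × (∀ x → ¬ (x ≈ 0#) → ∃ λ y → y * x ≈ 1#)

  CharZero : Set ℓ
  CharZero = ∀ n → ¬ (fromℕ (suc n) ≈ 0#)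

-- Write a = a₁, Λ = λᵃ, and let Sₙ(t) = Eₙ(t)/(1 - t)ⁿ⁺¹ be the regularised value of Σ_{k ≥ 0} kⁿ tᵏ,
-- Eₙ being the Eulerian polynomial Σⱼ ⟨n, n - j⟩ tʲ. Its characteristic property is the recurrence
-- Sᵣ - t Σₙ (r choose n) Sₙ = [r = 0], obtained by induction on r: applying t d/dt (realised with dual
-- numbers) to the recurrence at r gives the one at r + 1, because t d/dt Sₙ = Sₙ₊₁ is the Eulerian
-- recurrence Eₙ₊₁ = (n + 1) t Eₙ + t (1 - t) Eₙ′, proved by inserting n + 1 into permutations of 1, …, n.
--
-- An integer n > 0 lies in NR(A) iff n < m_(n mod a), so each residue class i contributes
-- i, i + a, …, m_i - a, and Σ_{n ∈ NR(A)} g(n) telescopes to Σᵢ (F(mᵢ) - F(i)) whenever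
-- F(y + a) - F(y) = g(y). For g(y) = λʸ y^μ take F(x) = -λˣ Q(x) with the Appell polynomial
-- Q(X) = Σₙ (μ choose n) aⁿ Sₙ(Λ) X^(μ-n), which satisfies Q(X) - Λ Q(X + a) = X^μ by the recurrence at Λ.
-- The terms F(mᵢ) give the first sum of the formula. The terms F(i), i < a, sum to -L with
-- L = Σᵢ λⁱ Q(i), and L satisfies the same recurrence at λ, so L = S_μ(λ): the second summand.

module Submission where

open import Defs
open import Level using (Level; _⊔_)
open import Data.Nat.Base as ℕ using (ℕ; zero; suc; _≤_; _<_; z≤n; s≤s; _∸_; _<ᵇ_; _≡ᵇ_; _%_; _/_; NonZero)
import Data.Nat.Properties as ℕ
open import Data.Nat.Combinatorics using (_C_; nCk+nC[k+1]≡[n+1]C[k+1]; k>n⇒nCk≡0; nCn≡1)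
open import Data.Nat.DivMod using (m≡m%n+[m/n]*n; m%n<n; m%n≤m; [m+kn]%n≡m%n; m<n⇒m%n≡m)
open import Data.Nat.Divisibility as ℕ using (divides; ∣⇒≤)
open import Data.Nat.Induction using (<-rec)
open import Data.Nat.Tactic.RingSolver using (solve-∀)
open import Data.Integer.Base as ℤ using (ℤ; +_; -[1+_])
import Data.Integer.Properties as ℤ
open import Data.Integer.Divisibility using () renaming (_∣_ to _∣ℤ_)
open import Data.Sign.Base as Sign using (Sign)
open import Data.Bool.Base as Bool using (Bool; true; false; if_then_else_)
open import Data.Unit.Base using (tt)
open import Data.Maybe.Base using (Maybe; just; nothing)
open import Data.Empty using (⊥-elim)
open import Data.Fin.Base as Fin using (Fin)
open import Data.Vec.Base using (Vec; []; _∷_; lookup; replicate)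
open import Data.List.Base using (List; []; _∷_; map; concatMap; length; filterᵇ; upTo; foldr; _++_)
import Data.List.Properties as List
open import Data.List.Relation.Unary.All as All using (All; []; _∷_)
import Data.List.Relation.Unary.All.Properties as All
open import Data.List.Relation.Unary.Any using (here; there)
open import Data.List.Membership.DecPropositional ℕ._≟_ using (_∈_; _∉_; _∈?_)
open import Data.List.Relation.Unary.Unique.Propositional using (Unique; []; _∷_)
open import Data.Product.Base using (_×_; _,_; proj₁; proj₂; ∃)
open import Function.Base using (_∘_)
open import Function.Bundles using (_⇔_; Equivalence)
open import Relation.Nullary using (¬_; Dec; yes; no; does)
open import Relation.Binary.PropositionalEquality as ≡ using (_≡_; _≢_)
open import Algebra.Bundles using (CommutativeRing)
open import Algebra.Solver.Ring.AlmostCommutativeRing using (_-Raw-AlmostCommutative⟶_; fromCommutativeRing)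

module IntegerSolver {c ℓ : Level} (R : CommutativeRing c ℓ) where
  open CommutativeRing R
  open import Algebra.Properties.Ring ring using (-‿distribˡ-*; -‿distribʳ-*; -0#≈0#)
  open import Algebra.Properties.AbelianGroup +-abelianGroup using (⁻¹-∙-comm; ⁻¹-involutive)
  open import Algebra.Properties.Monoid.Mult.TCOptimised +-monoid using (×-homo-+) renaming (_×_ to _×′_)
  open import Algebra.Properties.Semiring.Mult.TCOptimised semiring using (×1-homo-*)
  open import Relation.Binary.Reasoning.Setoid setoid

  -- The optimised multiple `_×′_` has `1 ×′ x = x`, so `fromℤ (+ 1)` is `1#` itself and the
  -- solver constant `:1` below denotes `1#` definitionally.
  fromℤ : ℤ → Carrier
  fromℤ (+ n)    = n ×′ 1#
  fromℤ -[1+ n ] = - (suc n ×′ 1#)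

  private
    suc×1# : ∀ n → suc n ×′ 1# ≈ 1# + n ×′ 1#
    suc×1# n = ×-homo-+ 1# 1 n

    1+x-[1+y]≈x-y : ∀ x y → (1# + x) - (1# + y) ≈ x - y
    1+x-[1+y]≈x-y x y = begin
      (1# + x) + - (1# + y)   ≈⟨ +-congˡ (sym (⁻¹-∙-comm 1# y)) ⟩
      (1# + x) + (- 1# + - y) ≈⟨ +-congʳ (+-comm 1# x) ⟩
      (x + 1#) + (- 1# + - y) ≈⟨ +-assoc x 1# _ ⟩
      x + (1# + (- 1# + - y)) ≈⟨ +-congˡ (sym (+-assoc 1# (- 1#) (- y))) ⟩
      x + ((1# - 1#) + - y)   ≈⟨ +-congˡ (+-congʳ (-‿inverseʳ 1#)) ⟩
      x + (0# + - y)          ≈⟨ +-congˡ (+-identityˡ (- y)) ⟩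
      x - y                   ∎

  fromℤ-⊖ : ∀ m n → fromℤ (m ℤ.⊖ n) ≈ m ×′ 1# - n ×′ 1#
  fromℤ-⊖ zero    zero    = sym (-‿inverseʳ 0#)
  fromℤ-⊖ zero    (suc n) = sym (+-identityˡ _)
  fromℤ-⊖ (suc m) zero    = sym (trans (+-congˡ -0#≈0#) (+-identityʳ _))
  fromℤ-⊖ (suc m) (suc n) = begin
    fromℤ (suc m ℤ.⊖ suc n)           ≡⟨ ≡.cong fromℤ (ℤ.[1+m]⊖[1+n]≡m⊖n m n) ⟩
    fromℤ (m ℤ.⊖ n)                   ≈⟨ fromℤ-⊖ m n ⟩
    m ×′ 1# - n ×′ 1#                 ≈⟨ 1+x-[1+y]≈x-y _ _ ⟨
    (1# + m ×′ 1#) - (1# + n ×′ 1#)   ≈⟨ +-cong (suc×1# m) (-‿cong (suc×1# n)) ⟨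
    suc m ×′ 1# - suc n ×′ 1#         ∎

  fromℤ-+ : ∀ i j → fromℤ (i ℤ.+ j) ≈ fromℤ i + fromℤ j
  fromℤ-+ (+ m)    (+ n)    = ×-homo-+ 1# m n
  fromℤ-+ (+ m)    -[1+ n ] = fromℤ-⊖ m (suc n)
  fromℤ-+ -[1+ m ] (+ n)    = trans (fromℤ-⊖ n (suc m)) (+-comm _ _)
  fromℤ-+ -[1+ m ] -[1+ n ] = begin
    - (suc (suc (m ℕ.+ n)) ×′ 1#)       ≡⟨ ≡.cong (λ k → - (suc k ×′ 1#)) (ℕ.+-suc m n) ⟨
    - ((suc m ℕ.+ suc n) ×′ 1#)         ≈⟨ -‿cong (×-homo-+ 1# (suc m) (suc n)) ⟩
    - (suc m ×′ 1# + suc n ×′ 1#)       ≈⟨ ⁻¹-∙-comm _ _ ⟨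
    - (suc m ×′ 1#) + - (suc n ×′ 1#)   ∎

  fromℤ-neg : ∀ i → fromℤ (ℤ.- i) ≈ - fromℤ i
  fromℤ-neg (+ zero)  = sym -0#≈0#
  fromℤ-neg (+ suc n) = refl
  fromℤ-neg -[1+ n ]  = sym (⁻¹-involutive _)

  private
    signed : Sign → Carrier → Carrier
    signed Sign.+ x = x
    signed Sign.- x = - x

    fromℤ-◃ : ∀ s n → fromℤ (s ℤ.◃ n) ≈ signed s (n ×′ 1#)
    fromℤ-◃ Sign.+ zero    = refl
    fromℤ-◃ Sign.- zero    = sym -0#≈0#
    fromℤ-◃ Sign.+ (suc n) = refl
    fromℤ-◃ Sign.- (suc n) = refl

    fromℤ-signAbs : ∀ i → fromℤ i ≈ signed (ℤ.sign i) (ℤ.∣ i ∣ ×′ 1#)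
    fromℤ-signAbs (+ n)    = refl
    fromℤ-signAbs -[1+ n ] = refl

    signed-cong : ∀ s {x y} → x ≈ y → signed s x ≈ signed s y
    signed-cong Sign.+ x≈y = x≈y
    signed-cong Sign.- x≈y = -‿cong x≈y

    signed-* : ∀ s t x y → signed (s Sign.* t) (x * y) ≈ signed s x * signed t y
    signed-* Sign.+ Sign.+ x y = refl
    signed-* Sign.+ Sign.- x y = -‿distribʳ-* x y
    signed-* Sign.- Sign.+ x y = -‿distribˡ-* x y
    signed-* Sign.- Sign.- x y = begin
      x * y           ≈⟨ ⁻¹-involutive (x * y) ⟨
      - - (x * y)     ≈⟨ -‿cong (-‿distribˡ-* x y) ⟩
      - (- x * y)     ≈⟨ -‿distribʳ-* (- x) y ⟩
      - x * - y       ∎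

  fromℤ-* : ∀ i j → fromℤ (i ℤ.* j) ≈ fromℤ i * fromℤ j
  fromℤ-* i j = begin
    fromℤ (s Sign.* t ℤ.◃ ℤ.∣ i ∣ ℕ.* ℤ.∣ j ∣)           ≈⟨ fromℤ-◃ (s Sign.* t) (ℤ.∣ i ∣ ℕ.* ℤ.∣ j ∣) ⟩
    signed (s Sign.* t) ((ℤ.∣ i ∣ ℕ.* ℤ.∣ j ∣) ×′ 1#)     ≈⟨ signed-cong (s Sign.* t) (×1-homo-* ℤ.∣ i ∣ ℤ.∣ j ∣) ⟩
    signed (s Sign.* t) (ℤ.∣ i ∣ ×′ 1# * ℤ.∣ j ∣ ×′ 1#)   ≈⟨ signed-* s t _ _ ⟩
    signed s (ℤ.∣ i ∣ ×′ 1#) * signed t (ℤ.∣ j ∣ ×′ 1#)   ≈⟨ *-cong (fromℤ-signAbs i) (fromℤ-signAbs j) ⟨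
    fromℤ i * fromℤ j                                    ∎
    where
    s t : Sign
    s = ℤ.sign i
    t = ℤ.sign j

  fromℤ-homomorphism : ℤ.+-*-rawRing -Raw-AlmostCommutative⟶ fromCommutativeRing R
  fromℤ-homomorphism = record
    { ⟦_⟧ = fromℤ ; +-homo = fromℤ-+ ; *-homo = fromℤ-* ; -‿homo = fromℤ-neg
    ; 0-homo = refl ; 1-homo = refl }

  fromℤ-≟ : ∀ i j → Maybe (fromℤ i ≈ fromℤ j)
  fromℤ-≟ i j with i ℤ.≟ j
  ... | yes ≡.refl = just refl
  ... | no _       = nothing

  open import Algebra.Solver.Ring ℤ.+-*-rawRing (fromCommutativeRing R) fromℤ-homomorphism fromℤ-≟ public

  :0 :1 : ∀ {n} → Polynomial n
  :0 = con (+ 0)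
  :1 = con (+ 1)

module RingSums {c ℓ : Level} (R : CommutativeRing c ℓ) where
  open CommutativeRing R
  open RingOps R
  open IntegerSolver R
  open import Relation.Binary.Reasoning.Setoid setoid

  fromℕ-+ : ∀ m n → fromℕ (m ℕ.+ n) ≈ fromℕ m + fromℕ n
  fromℕ-+ zero    n = sym (+-identityˡ _)
  fromℕ-+ (suc m) n = trans (+-congˡ (fromℕ-+ m n)) (sym (+-assoc _ _ _))

  fromℕ-* : ∀ m n → fromℕ (m ℕ.* n) ≈ fromℕ m * fromℕ n
  fromℕ-* zero    n = sym (zeroˡ _)
  fromℕ-* (suc m) n = begin
    fromℕ (n ℕ.+ m ℕ.* n)              ≈⟨ fromℕ-+ n (m ℕ.* n) ⟩
    fromℕ n + fromℕ (m ℕ.* n)          ≈⟨ +-cong (sym (*-identityˡ _)) (fromℕ-* m n) ⟩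
    1# * fromℕ n + fromℕ m * fromℕ n   ≈⟨ distribʳ _ _ _ ⟨
    (1# + fromℕ m) * fromℕ n           ∎

  pow-cong : ∀ n {x y} → x ≈ y → pow x n ≈ pow y n
  pow-cong zero    x≈y = refl
  pow-cong (suc n) x≈y = *-cong x≈y (pow-cong n x≈y)

  pow-+ : ∀ x m n → pow x (m ℕ.+ n) ≈ pow x m * pow x n
  pow-+ x zero    n = sym (*-identityˡ _)
  pow-+ x (suc m) n = trans (*-congˡ (pow-+ x m n)) (sym (*-assoc _ _ _))

  pow-* : ∀ x m n → pow x (m ℕ.* n) ≈ pow (pow x n) m
  pow-* x zero    n = refl
  pow-* x (suc m) n = trans (pow-+ x n (m ℕ.* n)) (*-congˡ (pow-* x m n))

  pow-distrib-* : ∀ x y n → pow (x * y) n ≈ pow x n * pow y n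
  pow-distrib-* x y zero    = sym (*-identityˡ _)
  pow-distrib-* x y (suc n) = trans (*-congˡ (pow-distrib-* x y n))
    (solve 4 (λ x y a b → (x :* y) :* (a :* b) := (x :* a) :* (y :* b)) refl x y _ _)

  pow-1# : ∀ n → pow 1# n ≈ 1#
  pow-1# zero    = refl
  pow-1# (suc n) = trans (*-identityˡ _) (pow-1# n)

  fromℕ-^ : ∀ m n → fromℕ (m ℕ.^ n) ≈ pow (fromℕ m) n
  fromℕ-^ m zero    = +-identityʳ 1#
  fromℕ-^ m (suc n) = trans (fromℕ-* m (m ℕ.^ n)) (*-congˡ (fromℕ-^ m n))

  sumTo-cong≤ : ∀ n {f g : ℕ → Carrier} → (∀ j → j ≤ n → f j ≈ g j) → sumTo n f ≈ sumTo n g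
  sumTo-cong≤ zero    f≈g = f≈g 0 z≤n
  sumTo-cong≤ (suc n) f≈g = +-cong (sumTo-cong≤ n (λ j j≤n → f≈g j (ℕ.m≤n⇒m≤1+n j≤n))) (f≈g (suc n) ℕ.≤-refl)

  sumTo-cong : ∀ n {f g : ℕ → Carrier} → (∀ j → f j ≈ g j) → sumTo n f ≈ sumTo n g
  sumTo-cong n f≈g = sumTo-cong≤ n (λ j _ → f≈g j)

  sumTo-zero : ∀ n (f : ℕ → Carrier) → (∀ j → j ≤ n → f j ≈ 0#) → sumTo n f ≈ 0#
  sumTo-zero zero    f f≈0 = f≈0 0 z≤n
  sumTo-zero (suc n) f f≈0 = trans (+-cong (sumTo-zero n f (λ j j≤n → f≈0 j (ℕ.m≤n⇒m≤1+n j≤n))) (f≈0 (suc n) ℕ.≤-refl)) (+-identityʳ 0#)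

  sumTo-distrib-+ : ∀ n (f g : ℕ → Carrier) → sumTo n (λ j → f j + g j) ≈ sumTo n f + sumTo n g
  sumTo-distrib-+ zero    f g = refl
  sumTo-distrib-+ (suc n) f g = trans (+-congʳ (sumTo-distrib-+ n f g))
    (solve 4 (λ a b c d → (a :+ b) :+ (c :+ d) := (a :+ c) :+ (b :+ d)) refl _ _ _ _)

  sumTo-neg : ∀ n (f : ℕ → Carrier) → sumTo n (λ j → - f j) ≈ - sumTo n f
  sumTo-neg zero    f = refl
  sumTo-neg (suc n) f = trans (+-congʳ (sumTo-neg n f)) (solve 2 (λ a b → :- a :+ :- b := :- (a :+ b)) refl _ _)

  sumTo-distrib-minus : ∀ n (f g : ℕ → Carrier) → sumTo n (λ j → f j - g j) ≈ sumTo n f - sumTo n g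
  sumTo-distrib-minus n f g = trans (sumTo-distrib-+ n f (λ j → - g j)) (+-congˡ (sumTo-neg n g))

  *-distribˡ-sumTo : ∀ n x (f : ℕ → Carrier) → x * sumTo n f ≈ sumTo n (λ j → x * f j)
  *-distribˡ-sumTo zero    x f = refl
  *-distribˡ-sumTo (suc n) x f = trans (distribˡ _ _ _) (+-congʳ (*-distribˡ-sumTo n x f))

  sumTo-suc : ∀ n (f : ℕ → Carrier) → sumTo (suc n) f ≈ f 0 + sumTo n (λ j → f (suc j))
  sumTo-suc zero    f = refl
  sumTo-suc (suc n) f = trans (+-congʳ (sumTo-suc n f)) (+-assoc _ _ _)

  sumTo-comm : ∀ m n (h : ℕ → ℕ → Carrier) →
    sumTo m (λ i → sumTo n (λ j → h i j)) ≈ sumTo n (λ j → sumTo m (λ i → h i j))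
  sumTo-comm zero    n h = refl
  sumTo-comm (suc m) n h =
    trans (+-congʳ (sumTo-comm m n h)) (sym (sumTo-distrib-+ n _ _))

  sumTo-reverse : ∀ n (f : ℕ → Carrier) → sumTo n f ≈ sumTo n (λ j → f (n ∸ j))
  sumTo-reverse zero    f = refl
  sumTo-reverse (suc n) f = begin
    sumTo n f + f (suc n)                     ≈⟨ +-comm _ _ ⟩
    f (suc n) + sumTo n f                     ≈⟨ +-congˡ (sumTo-reverse n f) ⟩
    f (suc n) + sumTo n (λ j → f (n ∸ j))     ≈⟨ sumTo-suc n (λ j → f (suc n ∸ j)) ⟨
    sumTo (suc n) (λ j → f (suc n ∸ j))       ∎

  -- Agrees definitionally with `sumList` on lists of naturals.
  sumOver : {A : Set} → List A → (A → Carrier) → Carrier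
  sumOver xs f = foldr (λ x acc → f x + acc) 0# xs

  sumOver-++ : {A : Set} (xs ys : List A) (f : A → Carrier) → sumOver (xs ++ ys) f ≈ sumOver xs f + sumOver ys f
  sumOver-++ []       ys f = sym (+-identityˡ _)
  sumOver-++ (x ∷ xs) ys f = trans (+-congˡ (sumOver-++ xs ys f)) (sym (+-assoc _ _ _))

  sumOver-concatMap : {A B : Set} (g : A → List B) (xs : List A) (f : B → Carrier) →
    sumOver (concatMap g xs) f ≈ sumOver xs (λ x → sumOver (g x) f)
  sumOver-concatMap g []       f = refl
  sumOver-concatMap g (x ∷ xs) f = trans (sumOver-++ (g x) (concatMap g xs) f) (+-congˡ (sumOver-concatMap g xs f))

  sumOver-map : {A B : Set} (h : A → B) (xs : List A) (f : B → Carrier) → sumOver (map h xs) f ≡ sumOver xs (f ∘ h)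
  sumOver-map h []       f = ≡.refl
  sumOver-map h (x ∷ xs) f = ≡.cong (λ s → f (h x) + s) (sumOver-map h xs f)

  sumOver-cong-All : {A : Set} {P : A → Set} {xs : List A} {f g : A → Carrier} →
    All P xs → (∀ {x} → P x → f x ≈ g x) → sumOver xs f ≈ sumOver xs g
  sumOver-cong-All []         f≈g = refl
  sumOver-cong-All (px ∷ pxs) f≈g = +-cong (f≈g px) (sumOver-cong-All pxs f≈g)

  sumOver-cong : {A : Set} (xs : List A) {f g : A → Carrier} → (∀ x → f x ≈ g x) → sumOver xs f ≈ sumOver xs g
  sumOver-cong []       f≈g = refl
  sumOver-cong (x ∷ xs) f≈g = +-cong (f≈g x) (sumOver-cong xs f≈g)

  sumOver-distrib-+ : {A : Set} (xs : List A) (f g : A → Carrier) → sumOver xs (λ x → f x + g x) ≈ sumOver xs f + sumOver xs g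
  sumOver-distrib-+ []       f g = sym (+-identityˡ _)
  sumOver-distrib-+ (x ∷ xs) f g = trans (+-congˡ (sumOver-distrib-+ xs f g))
    (solve 4 (λ a b c d → (a :+ b) :+ (c :+ d) := (a :+ c) :+ (b :+ d)) refl _ _ _ _)

  *-distribˡ-sumOver : {A : Set} (xs : List A) (y : Carrier) (f : A → Carrier) → y * sumOver xs f ≈ sumOver xs (λ x → y * f x)
  *-distribˡ-sumOver []       y f = zeroʳ _
  *-distribˡ-sumOver (x ∷ xs) y f = trans (distribˡ _ _ _) (+-congˡ (*-distribˡ-sumOver xs y f))

  indicator : Bool → Carrier
  indicator true  = 1#
  indicator false = 0#

  sumBelow : ℕ → (ℕ → Carrier) → Carrier
  sumBelow zero    f = 0#
  sumBelow (suc n) f = sumBelow n f + f n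

  sumBelow-cong< : ∀ n {f g : ℕ → Carrier} → (∀ j → j < n → f j ≈ g j) → sumBelow n f ≈ sumBelow n g
  sumBelow-cong< zero    f≈g = refl
  sumBelow-cong< (suc n) f≈g = +-cong (sumBelow-cong< n (λ j j<n → f≈g j (ℕ.m≤n⇒m≤1+n j<n))) (f≈g n ℕ.≤-refl)

  sumBelow-zero : ∀ n (f : ℕ → Carrier) → (∀ j → j < n → f j ≈ 0#) → sumBelow n f ≈ 0#
  sumBelow-zero zero    f f≈0 = refl
  sumBelow-zero (suc n) f f≈0 = trans (+-cong (sumBelow-zero n f (λ j j<n → f≈0 j (ℕ.m≤n⇒m≤1+n j<n))) (f≈0 n ℕ.≤-refl)) (+-identityʳ 0#)

  sumBelow-distrib-+ : ∀ n (f g : ℕ → Carrier) → sumBelow n (λ j → f j + g j) ≈ sumBelow n f + sumBelow n g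
  sumBelow-distrib-+ zero    f g = sym (+-identityˡ 0#)
  sumBelow-distrib-+ (suc n) f g = trans (+-congʳ (sumBelow-distrib-+ n f g))
    (solve 4 (λ a b c d → (a :+ b) :+ (c :+ d) := (a :+ c) :+ (b :+ d)) refl _ _ _ _)

  sumBelow-suc : ∀ n (f : ℕ → Carrier) → sumBelow (suc n) f ≈ sumTo n f
  sumBelow-suc zero    f = +-identityˡ _
  sumBelow-suc (suc n) f = +-congʳ (sumBelow-suc n f)

  sumBelow-+ : ∀ m n (f : ℕ → Carrier) → sumBelow (m ℕ.+ n) f ≈ sumBelow m f + sumBelow n (λ j → f (m ℕ.+ j))
  sumBelow-+ m zero    f = trans (reflexive (≡.cong (λ k → sumBelow k f) (ℕ.+-identityʳ m))) (sym (+-identityʳ _))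
  sumBelow-+ m (suc n) f = begin
    sumBelow (m ℕ.+ suc n) f                                       ≡⟨ ≡.cong (λ k → sumBelow k f) (ℕ.+-suc m n) ⟩
    sumBelow (m ℕ.+ n) f + f (m ℕ.+ n)                             ≈⟨ +-congʳ (sumBelow-+ m n f) ⟩
    (sumBelow m f + sumBelow n (λ j → f (m ℕ.+ j))) + f (m ℕ.+ n)  ≈⟨ +-assoc _ _ _ ⟩
    sumBelow m f + sumBelow (suc n) (λ j → f (m ℕ.+ j))            ∎

  sumBelow-comm : ∀ m n (h : ℕ → ℕ → Carrier) →
    sumBelow m (λ i → sumBelow n (λ j → h i j)) ≈ sumBelow n (λ j → sumBelow m (λ i → h i j))
  sumBelow-comm zero    n h = sym (sumBelow-zero n _ (λ _ _ → refl))
  sumBelow-comm (suc m) n h = trans (+-congʳ (sumBelow-comm m n h)) (sym (sumBelow-distrib-+ n _ _))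

  sumBelow-* : ∀ m n (f : ℕ → Carrier) → sumBelow (m ℕ.* n) f ≈ sumBelow m (λ t → sumBelow n (λ i → f (i ℕ.+ t ℕ.* n)))
  sumBelow-* zero    n f = refl
  sumBelow-* (suc m) n f = begin
    sumBelow (n ℕ.+ m ℕ.* n) f                                   ≡⟨ ≡.cong (λ k → sumBelow k f) (ℕ.+-comm n (m ℕ.* n)) ⟩
    sumBelow (m ℕ.* n ℕ.+ n) f                                   ≈⟨ sumBelow-+ (m ℕ.* n) n f ⟩
    sumBelow (m ℕ.* n) f + sumBelow n (λ i → f (m ℕ.* n ℕ.+ i))
      ≈⟨ +-cong (sumBelow-* m n f) (sumBelow-cong< n (λ i _ → reflexive (≡.cong f (ℕ.+-comm (m ℕ.* n) i)))) ⟩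
    sumBelow (suc m) (λ t → sumBelow n (λ i → f (i ℕ.+ t ℕ.* n))) ∎

  indicator-≡ᵇ-refl : ∀ x → indicator (x ℕ.≡ᵇ x) ≈ 1#
  indicator-≡ᵇ-refl zero    = refl
  indicator-≡ᵇ-refl (suc x) = indicator-≡ᵇ-refl x

  indicator-≡ᵇ-≢ : ∀ x y → x ≢ y → indicator (x ℕ.≡ᵇ y) ≈ 0#
  indicator-≡ᵇ-≢ x y x≢y with x ℕ.≡ᵇ y in eq
  ... | true  = ⊥-elim (x≢y (ℕ.≡ᵇ⇒≡ x y (≡.subst Bool.T (≡.sym eq) tt)))
  ... | false = refl

  sumBelow-indicator-≥ : ∀ n x (g : ℕ → Carrier) → n ≤ x → sumBelow n (λ j → indicator (x ℕ.≡ᵇ j) * g j) ≈ 0#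
  sumBelow-indicator-≥ n x g n≤x = sumBelow-zero n _ (λ j j<n →
    trans (*-congʳ (indicator-≡ᵇ-≢ x j (λ x≡j → ℕ.<-irrefl (≡.sym x≡j) (ℕ.<-≤-trans j<n n≤x)))) (zeroˡ _))

  sumBelow-indicator : ∀ n x (g : ℕ → Carrier) → x < n → sumBelow n (λ j → indicator (x ℕ.≡ᵇ j) * g j) ≈ g x
  sumBelow-indicator (suc n) x g x<1+n with x ℕ.≟ n
  ... | yes ≡.refl = trans (+-cong (sumBelow-indicator-≥ n x g ℕ.≤-refl) (trans (*-congʳ (indicator-≡ᵇ-refl x)) (*-identityˡ _))) (+-identityˡ _)
  ... | no x≢n     = trans (+-cong (sumBelow-indicator n x g (ℕ.≤∧≢⇒< (ℕ.≤-pred x<1+n) x≢n)) (trans (*-congʳ (indicator-≡ᵇ-≢ x n x≢n)) (zeroˡ _))) (+-identityʳ _)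

  sumTo-indicator : ∀ n x (g : ℕ → Carrier) → x ≤ n → sumTo n (λ j → indicator (x ℕ.≡ᵇ j) * g j) ≈ g x
  sumTo-indicator n x g x≤n = trans (sym (sumBelow-suc n _)) (sumBelow-indicator (suc n) x g (s≤s x≤n))

module Appell {c ℓ : Level} (R : CommutativeRing c ℓ) where
  open CommutativeRing R
  open RingOps R
  open IntegerSolver R
  open RingSums R
  open import Relation.Binary.Reasoning.Setoid setoid

  binom : ℕ → ℕ → Carrier
  binom r n = fromℕ (r C n)

  sumTo-pascal : ∀ r (f : ℕ → Carrier) →
    sumTo (suc r) (λ n → binom (suc r) n * f n)
      ≈ sumTo r (λ n → binom r n * f n) + sumTo r (λ n → binom r n * f (suc n))
  sumTo-pascal r f = begin
    sumTo (suc r) (λ n → binom (suc r) n * f n)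
      ≈⟨ sumTo-suc r _ ⟩
    binom (suc r) 0 * f 0 + sumTo r (λ n → binom (suc r) (suc n) * f (suc n))
      ≈⟨ +-congˡ (sumTo-cong r pascal) ⟩
    binom r 0 * f 0 + sumTo r (λ n → binom r n * f (suc n) + binom r (suc n) * f (suc n))
      ≈⟨ +-congˡ (sumTo-distrib-+ r _ _) ⟩
    binom r 0 * f 0 + (sumTo r (λ n → binom r n * f (suc n)) + sumTo r (λ n → binom r (suc n) * f (suc n)))
      ≈⟨ solve 3 (λ a b c → a :+ (b :+ c) := (a :+ c) :+ b) refl _ _ _ ⟩
    (binom r 0 * f 0 + sumTo r (λ n → binom r (suc n) * f (suc n))) + sumTo r (λ n → binom r n * f (suc n))
      ≈⟨ +-congʳ (sumTo-suc r (λ n → binom r n * f n)) ⟨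
    sumTo (suc r) (λ n → binom r n * f n) + sumTo r (λ n → binom r n * f (suc n))
      ≈⟨ +-congʳ (trans (+-congˡ vanishing) (+-identityʳ _)) ⟩
    sumTo r (λ n → binom r n * f n) + sumTo r (λ n → binom r n * f (suc n)) ∎
    where
    pascal : ∀ n → binom (suc r) (suc n) * f (suc n) ≈ binom r n * f (suc n) + binom r (suc n) * f (suc n)
    pascal n = begin
      binom (suc r) (suc n) * f (suc n)                    ≡⟨ ≡.cong (λ k → fromℕ k * f (suc n)) (nCk+nC[k+1]≡[n+1]C[k+1] r n) ⟨
      fromℕ (r C n ℕ.+ r C suc n) * f (suc n)             ≈⟨ *-congʳ (fromℕ-+ (r C n) (r C suc n)) ⟩
      (binom r n + binom r (suc n)) * f (suc n)            ≈⟨ distribʳ _ _ _ ⟩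
      binom r n * f (suc n) + binom r (suc n) * f (suc n) ∎
    vanishing : binom r (suc r) * f (suc r) ≈ 0#
    vanishing = trans (*-congʳ (reflexive (≡.cong fromℕ (k>n⇒nCk≡0 (ℕ.n<1+n r))))) (zeroˡ _)

  -- The umbral power (s + X)ʳ.
  appell : (ℕ → Carrier) → ℕ → Carrier → Carrier
  appell s r X = sumTo r (λ n → binom r n * (s n * pow X (r ∸ n)))

  appell-suc : ∀ s r X → appell s (suc r) X ≈ X * appell s r X + appell (s ∘ suc) r X
  appell-suc s r X = begin
    appell s (suc r) X                 ≈⟨ sumTo-pascal r (λ n → s n * pow X (suc r ∸ n)) ⟩
    sumTo r (λ n → binom r n * (s n * pow X (suc r ∸ n))) + appell (s ∘ suc) r X
      ≈⟨ +-congʳ (sumTo-cong≤ r raise) ⟩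
    sumTo r (λ n → X * (binom r n * (s n * pow X (r ∸ n)))) + appell (s ∘ suc) r X
      ≈⟨ +-congʳ (*-distribˡ-sumTo r X _) ⟨
    X * appell s r X + appell (s ∘ suc) r X ∎
    where
    raise : ∀ n → n ≤ r → binom r n * (s n * pow X (suc r ∸ n)) ≈ X * (binom r n * (s n * pow X (r ∸ n)))
    raise n n≤r rewrite ℕ.+-∸-assoc 1 n≤r =
      solve 4 (λ x b a p → b :* (a :* (x :* p)) := x :* (b :* (a :* p))) refl X _ _ _

  appell-+ : ∀ s r X Y → appell s r (X + Y) ≈ sumTo r (λ j → binom r j * (appell s j X * pow Y (r ∸ j)))
  appell-+ s zero    X Y = solve 1 (λ a → (:1 :+ :0) :* (a :* :1)
                             := (:1 :+ :0) :* ((:1 :+ :0) :* (a :* :1) :* :1)) refl (s 0)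
  appell-+ s (suc r) X Y = begin
    appell s (suc r) (X + Y)
      ≈⟨ appell-suc s r (X + Y) ⟩
    (X + Y) * appell s r (X + Y) + appell (s ∘ suc) r (X + Y)
      ≈⟨ +-cong (*-congˡ (appell-+ s r X Y)) (appell-+ (s ∘ suc) r X Y) ⟩
    (X + Y) * sumTo r (λ j → binom r j * term j) + sumTo r (λ j → binom r j * (appell (s ∘ suc) j X * pow Y (r ∸ j)))
      ≈⟨ +-congʳ (trans (distribʳ _ _ _) (+-cong (*-distribˡ-sumTo r X _) (*-distribˡ-sumTo r Y _))) ⟩
    (sumTo r (λ j → X * (binom r j * term j)) + sumTo r (λ j → Y * (binom r j * term j)))
      + sumTo r (λ j → binom r j * (appell (s ∘ suc) j X * pow Y (r ∸ j)))
      ≈⟨ solve 3 (λ a b c → (a :+ b) :+ c := b :+ (a :+ c)) refl _ _ _ ⟩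
    sumTo r (λ j → Y * (binom r j * term j))
      + (sumTo r (λ j → X * (binom r j * term j)) + sumTo r (λ j → binom r j * (appell (s ∘ suc) j X * pow Y (r ∸ j))))
      ≈⟨ +-cong (sumTo-cong≤ r raiseY) (trans (sym (sumTo-distrib-+ r _ _)) (sumTo-cong r raiseX)) ⟩
    sumTo r (λ j → binom r j * (appell s j X * pow Y (suc r ∸ j)))
      + sumTo r (λ j → binom r j * (appell s (suc j) X * pow Y (r ∸ j)))
      ≈⟨ sumTo-pascal r (λ j → appell s j X * pow Y (suc r ∸ j)) ⟨
    sumTo (suc r) (λ j → binom (suc r) j * (appell s j X * pow Y (suc r ∸ j))) ∎
    where
    term : ℕ → Carrier
    term j = appell s j X * pow Y (r ∸ j)
    raiseY : ∀ j → j ≤ r → Y * (binom r j * term j) ≈ binom r j * (appell s j X * pow Y (suc r ∸ j))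
    raiseY j j≤r rewrite ℕ.+-∸-assoc 1 j≤r =
      solve 4 (λ y b a p → y :* (b :* (a :* p)) := b :* (a :* (y :* p))) refl Y _ _ _
    raiseX : ∀ j → X * (binom r j * term j) + binom r j * (appell (s ∘ suc) j X * pow Y (r ∸ j))
                   ≈ binom r j * (appell s (suc j) X * pow Y (r ∸ j))
    raiseX j = begin
      X * (binom r j * term j) + binom r j * (appell (s ∘ suc) j X * pow Y (r ∸ j))
        ≈⟨ solve 5 (λ x b a a′ p → x :* (b :* (a :* p)) :+ b :* (a′ :* p) := b :* ((x :* a :+ a′) :* p)) refl X _ _ _ _ ⟩
      binom r j * ((X * appell s j X + appell (s ∘ suc) j X) * pow Y (r ∸ j))
        ≈⟨ *-congˡ (*-congʳ (appell-suc s j X)) ⟨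
      binom r j * (appell s (suc j) X * pow Y (r ∸ j)) ∎

inserts-map : ∀ (f : ℕ → ℕ) x p → inserts (f x) (map f p) ≡ map (map f) (inserts x p)
inserts-map f x []       = ≡.refl
inserts-map f x (y ∷ ys) = ≡.cong ((f x ∷ f y ∷ map f ys) ∷_) (begin
  map (f y ∷_) (inserts (f x) (map f ys))   ≡⟨ ≡.cong (map (f y ∷_)) (inserts-map f x ys) ⟩
  map (f y ∷_) (map (map f) (inserts x ys)) ≡⟨ List.map-∘ (inserts x ys) ⟨
  map (map f ∘ (y ∷_)) (inserts x ys)       ≡⟨ List.map-∘ (inserts x ys) ⟩
  map (map f) (map (y ∷_) (inserts x ys))   ∎)
  where open ≡.≡-Reasoning

perms-map : ∀ (f : ℕ → ℕ) xs → perms (map f xs) ≡ map (map f) (perms xs)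
perms-map f []       = ≡.refl
perms-map f (x ∷ xs) = begin
  concatMap (inserts (f x)) (perms (map f xs))        ≡⟨ ≡.cong (concatMap (inserts (f x))) (perms-map f xs) ⟩
  concatMap (inserts (f x)) (map (map f) (perms xs))  ≡⟨ List.concatMap-map (inserts (f x)) (map f) (perms xs) ⟩
  concatMap (inserts (f x) ∘ map f) (perms xs)        ≡⟨ List.concatMap-cong (inserts-map f x) (perms xs) ⟩
  concatMap (map (map f) ∘ inserts x) (perms xs)      ≡⟨ List.map-concatMap (map f) (inserts x) (perms xs) ⟨
  map (map f) (concatMap (inserts x) (perms xs))      ∎
  where open ≡.≡-Reasoning

perms-upTo-suc : ∀ n → perms (upTo (suc n)) ≡ concatMap (inserts 0) (map (map suc) (perms (upTo n)))
perms-upTo-suc n = ≡.cong (concatMap (inserts 0)) (≡.trans (≡.cong perms (≡.sym (List.map-upTo suc n))) (perms-map suc (upTo n)))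

ascents-map-suc : ∀ p → ascents (map suc p) ≡ ascents p
ascents-map-suc []           = ≡.refl
ascents-map-suc (x ∷ [])     = ≡.refl
ascents-map-suc (x ∷ y ∷ ys) = ≡.cong ((if x <ᵇ y then 1 else 0) ℕ.+_) (ascents-map-suc (y ∷ ys))

ascents-∷-≤ : ∀ x xs → ascents (x ∷ xs) ≤ length xs
ascents-∷-≤ x []       = z≤n
ascents-∷-≤ x (y ∷ ys) with x <ᵇ y
... | true  = s≤s (ascents-∷-≤ y ys)
... | false = ℕ.m≤n⇒m≤1+n (ascents-∷-≤ y ys)

ascents-≤ : ∀ p → ascents p ≤ length p
ascents-≤ []       = z≤n
ascents-≤ (x ∷ xs) = ℕ.m≤n⇒m≤1+n (ascents-∷-≤ x xs)

inserts-length : ∀ x p → All (λ q → length q ≡ suc (length p)) (inserts x p)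
inserts-length x []       = ≡.refl ∷ []
inserts-length x (y ∷ ys) = ≡.refl ∷ All.map⁺ (All.map (≡.cong suc) (inserts-length x ys))

perms-length : ∀ xs → All (λ q → length q ≡ length xs) (perms xs)
perms-length []       = ≡.refl ∷ []
perms-length (x ∷ xs) = All.concat⁺ (All.map⁺ (All.map extend (perms-length xs)))
  where
  extend : ∀ {q} → length q ≡ length xs → All (λ r → length r ≡ suc (length xs)) (inserts x q)
  extend q≡xs = All.map (λ r≡q → ≡.trans r≡q (≡.cong suc q≡xs)) (inserts-length x _)

perms-upTo-length : ∀ n → All (λ q → length q ≡ n) (perms (upTo n))
perms-upTo-length n = All.map (λ q≡ → ≡.trans q≡ (List.length-upTo n)) (perms-length (upTo n))

module EulerianPolynomials {c ℓ : Level} (R : CommutativeRing c ℓ) where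
  open CommutativeRing R
  open RingOps R
  open IntegerSolver R
  open RingSums R
  open import Relation.Binary.Reasoning.Setoid setoid

  eulerPoly : ℕ → Carrier → Carrier
  eulerPoly n t = sumTo n (λ j → fromℕ (eulerian n (n ∸ j)) * pow t j)

  -- The image of eulerPoly n under θ = t d/dt.
  eulerPolyθ : ℕ → Carrier → Carrier
  eulerPolyθ n t = sumTo n (λ j → fromℕ (eulerian n (n ∸ j)) * (fromℕ j * pow t j))

  private
    countAt : ℕ → List (List ℕ) → Carrier
    countAt l ps = fromℕ (length (filterᵇ (λ p → ascents p ≡ᵇ l) ps))

    countAt-∷ : ∀ l p ps → countAt l (p ∷ ps) ≈ indicator (ascents p ≡ᵇ l) + countAt l ps
    countAt-∷ l p ps with ascents p ≡ᵇ l
    ... | true  = refl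
    ... | false = sym (+-identityˡ _)

  sumTo-countAt : ∀ n ps (h : ℕ → Carrier) → All (λ p → ascents p ≤ n) ps →
    sumTo n (λ l → countAt l ps * h l) ≈ sumOver ps (h ∘ ascents)
  sumTo-countAt n []       h []          = sumTo-zero n _ (λ l _ → zeroˡ _)
  sumTo-countAt n (p ∷ ps) h (a≤n ∷ ps≤n) = begin
    sumTo n (λ l → countAt l (p ∷ ps) * h l)
      ≈⟨ sumTo-cong n (λ l → trans (*-congʳ (countAt-∷ l p ps)) (distribʳ _ _ _)) ⟩
    sumTo n (λ l → indicator (ascents p ≡ᵇ l) * h l + countAt l ps * h l)
      ≈⟨ sumTo-distrib-+ n _ _ ⟩
    sumTo n (λ l → indicator (ascents p ≡ᵇ l) * h l) + sumTo n (λ l → countAt l ps * h l)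
      ≈⟨ +-cong (sumTo-indicator n (ascents p) h a≤n) (sumTo-countAt n ps h ps≤n) ⟩
    h (ascents p) + sumOver ps (h ∘ ascents) ∎

  eulerian-sumTo : ∀ n (h : ℕ → Carrier) →
    sumTo n (λ j → fromℕ (eulerian n (n ∸ j)) * h j) ≈ sumOver (perms (upTo n)) (λ p → h (n ∸ ascents p))
  eulerian-sumTo n h = begin
    sumTo n (λ j → fromℕ (eulerian n (n ∸ j)) * h j)
      ≈⟨ sumTo-reverse n _ ⟩
    sumTo n (λ l → fromℕ (eulerian n (n ∸ (n ∸ l))) * h (n ∸ l))
      ≈⟨ sumTo-cong≤ n (λ l l≤n → reflexive (≡.cong (λ k → fromℕ (eulerian n k) * h (n ∸ l)) (ℕ.m∸[m∸n]≡n l≤n))) ⟩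
    sumTo n (λ l → countAt l (perms (oneTo n)) * h (n ∸ l))
      ≈⟨ sumTo-countAt n (perms (oneTo n)) (λ l → h (n ∸ l)) ascents≤n ⟩
    sumOver (perms (oneTo n)) (λ p → h (n ∸ ascents p))
      ≡⟨ ≡.trans (≡.cong (λ ps → sumOver ps (λ p → h (n ∸ ascents p))) (perms-map suc (upTo n))) (sumOver-map (map suc) (perms (upTo n)) (λ p → h (n ∸ ascents p))) ⟩
    sumOver (perms (upTo n)) (λ p → h (n ∸ ascents (map suc p)))
      ≈⟨ sumOver-cong (perms (upTo n)) (λ p → reflexive (≡.cong (λ k → h (n ∸ k)) (ascents-map-suc p))) ⟩
    sumOver (perms (upTo n)) (λ p → h (n ∸ ascents p)) ∎
    where
    ascents≤n : All (λ p → ascents p ≤ n) (perms (oneTo n))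
    ascents≤n = All.map (λ {p} p≡n → ℕ.≤-trans (ascents-≤ p) (ℕ.≤-reflexive (≡.trans p≡n oneTo-length)))
                        (perms-length (oneTo n))
      where
      oneTo-length : length (oneTo n) ≡ n
      oneTo-length = ≡.trans (List.length-map suc (upTo n)) (List.length-upTo n)

  private
    isAscent : ℕ → ℕ → ℕ
    isAscent x y = if x <ᵇ y then 1 else 0

    insertZero-cons : ∀ y z zs (g : ℕ → Carrier) →
      sumOver (inserts 0 (map suc (y ∷ z ∷ zs))) (g ∘ ascents)
        ≈ g (suc (ascents (z ∷ zs))) + sumOver (inserts 0 (map suc (z ∷ zs))) (λ q → g (isAscent y z ℕ.+ ascents q))
    insertZero-cons y z zs g = begin
      g (suc (b ℕ.+ A′)) + (g (suc A′) + sumOver (map (suc y ∷_) (map (suc z ∷_) I)) (g ∘ ascents))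
        ≡⟨ ≡.cong₂ (λ k M → g k + (g (suc A′) + M)) (≡.sym (ℕ.+-suc b A′)) tail≡ ⟩
      g (b ℕ.+ suc A′) + (g (suc A′) + sumOver (map (suc z ∷_) I) (λ q → g (b ℕ.+ ascents q)))
        ≈⟨ solve 3 (λ x y m → x :+ (y :+ m) := y :+ (x :+ m)) refl _ _ _ ⟩
      g (suc A′) + (g (b ℕ.+ suc A′) + sumOver (map (suc z ∷_) I) (λ q → g (b ℕ.+ ascents q)))
        ≡⟨ ≡.cong (λ k → g (suc k) + sumOver (inserts 0 (map suc (z ∷ zs))) (λ q → g (b ℕ.+ ascents q))) (ascents-map-suc (z ∷ zs)) ⟩
      g (suc (ascents (z ∷ zs))) + sumOver (inserts 0 (map suc (z ∷ zs))) (λ q → g (b ℕ.+ ascents q)) ∎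
      where
      b A′ : ℕ
      b  = isAscent y z
      A′ = ascents (map suc (z ∷ zs))
      I : List (List ℕ)
      I  = inserts 0 (map suc zs)
      tail≡ : sumOver (map (suc y ∷_) (map (suc z ∷_) I)) (g ∘ ascents) ≡ sumOver (map (suc z ∷_) I) (λ q → g (b ℕ.+ ascents q))
      tail≡ = ≡.trans (sumOver-map (suc y ∷_) (map (suc z ∷_) I) (g ∘ ascents))
             (≡.trans (sumOver-map (suc z ∷_) I _) (≡.sym (sumOver-map (suc z ∷_) I _)))

    insertZero-arith : ∀ β A n (g : ℕ → Carrier) → A ≤ suc n → let b = if β then 1 else 0 in
      g (suc A) + (fromℕ (suc A) * g (b ℕ.+ A) + fromℕ (suc n ∸ A) * g (b ℕ.+ suc A))
        ≈ fromℕ (suc (b ℕ.+ A)) * g (b ℕ.+ A) + fromℕ (suc (suc n) ∸ (b ℕ.+ A)) * g (suc (b ℕ.+ A))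
    insertZero-arith true  A n g A≤1+n =
      solve 4 (λ g₁ g₂ f d → g₁ :+ (f :* g₁ :+ d :* g₂) := (:1 :+ f) :* g₁ :+ d :* g₂) refl _ _ _ _
    insertZero-arith false A n g A≤1+n = begin
      g (suc A) + (fromℕ (suc A) * g A + fromℕ (suc n ∸ A) * g (suc A))
        ≈⟨ solve 4 (λ g₀ g₁ f d → g₁ :+ (f :* g₀ :+ d :* g₁) := f :* g₀ :+ (:1 :+ d) :* g₁) refl _ _ _ _ ⟩
      fromℕ (suc A) * g A + fromℕ (suc (suc n ∸ A)) * g (suc A)
        ≡⟨ ≡.cong (λ k → fromℕ (suc A) * g A + fromℕ k * g (suc A)) (ℕ.+-∸-assoc 1 A≤1+n) ⟨
      fromℕ (suc A) * g A + fromℕ (suc (suc n) ∸ A) * g (suc A) ∎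

  -- Inserting the new least element at the front or into a descent creates an ascent; inserting it
  -- at the end or into an ascent does not.
  insertZero : ∀ p (g : ℕ → Carrier) →
    sumOver (inserts 0 (map suc p)) (g ∘ ascents)
      ≈ fromℕ (suc (ascents p)) * g (ascents p) + fromℕ (length p ∸ ascents p) * g (suc (ascents p))
  insertZero []       g = solve 2 (λ g₀ g₁ → g₀ :+ :0 := (:1 :+ :0) :* g₀ :+ :0 :* g₁) refl (g 0) (g 1)
  insertZero (y ∷ []) g = solve 2 (λ g₀ g₁ → g₁ :+ (g₀ :+ :0)
                            := (:1 :+ :0) :* g₀ :+ (:1 :+ :0) :* g₁) refl (g 0) (g 1)
  insertZero (y ∷ z ∷ zs) g = begin
    sumOver (inserts 0 (map suc (y ∷ z ∷ zs))) (g ∘ ascents)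
      ≈⟨ insertZero-cons y z zs g ⟩
    g (suc A) + sumOver (inserts 0 (map suc (z ∷ zs))) (λ q → g (isAscent y z ℕ.+ ascents q))
      ≈⟨ +-congˡ (insertZero (z ∷ zs) (λ k → g (isAscent y z ℕ.+ k))) ⟩
    g (suc A) + (fromℕ (suc A) * g (isAscent y z ℕ.+ A) + fromℕ (suc (length zs) ∸ A) * g (isAscent y z ℕ.+ suc A))
      ≈⟨ insertZero-arith (y <ᵇ z) A (length zs) g (ascents-≤ (z ∷ zs)) ⟩
    fromℕ (suc (ascents (y ∷ z ∷ zs))) * g (ascents (y ∷ z ∷ zs))
      + fromℕ (length (y ∷ z ∷ zs) ∸ ascents (y ∷ z ∷ zs)) * g (suc (ascents (y ∷ z ∷ zs))) ∎
    where
    A : ℕ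
    A = ascents (z ∷ zs)

  private
    insertZero-pow : ∀ n t p → length p ≡ n →
      sumOver (inserts 0 (map suc p)) (λ q → pow t (suc n ∸ ascents q))
        ≈ fromℕ (suc n) * t * pow t (n ∸ ascents p) + (1# - t) * (fromℕ (n ∸ ascents p) * pow t (n ∸ ascents p))
    insertZero-pow n t p ≡.refl = begin
      sumOver (inserts 0 (map suc p)) (λ q → pow t (suc n ∸ ascents q))
        ≈⟨ insertZero p (λ k → pow t (suc n ∸ k)) ⟩
      fromℕ (suc a) * pow t (suc n ∸ a) + fromℕ (n ∸ a) * pow t (n ∸ a)
        ≡⟨ ≡.cong (λ k → fromℕ (suc a) * pow t k + fromℕ (n ∸ a) * pow t (n ∸ a)) (ℕ.+-∸-assoc 1 a≤n) ⟩
      fromℕ (suc a) * (t * pow t (n ∸ a)) + fromℕ (n ∸ a) * pow t (n ∸ a)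
        ≈⟨ solve 4 (λ f d x T → f :* (x :* T) :+ d :* T := (f :+ d) :* x :* T :+ (:1 :- x) :* (d :* T)) refl _ _ t _ ⟩
      (fromℕ (suc a) + fromℕ (n ∸ a)) * t * pow t (n ∸ a) + (1# - t) * (fromℕ (n ∸ a) * pow t (n ∸ a))
        ≈⟨ +-congʳ (*-congʳ (*-congʳ (trans (sym (fromℕ-+ (suc a) (n ∸ a))) (reflexive (≡.cong (fromℕ ∘ suc) (ℕ.m+[n∸m]≡n a≤n)))))) ⟩
      fromℕ (suc n) * t * pow t (n ∸ a) + (1# - t) * (fromℕ (n ∸ a) * pow t (n ∸ a)) ∎
      where
      a : ℕ
      a = ascents p
      a≤n : a ≤ n
      a≤n = ascents-≤ p

  eulerPoly-suc : ∀ n t → eulerPoly (suc n) t ≈ fromℕ (suc n) * t * eulerPoly n t + (1# - t) * eulerPolyθ n t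
  eulerPoly-suc n t = begin
    eulerPoly (suc n) t
      ≈⟨ eulerian-sumTo (suc n) (pow t) ⟩
    sumOver (perms (upTo (suc n))) (λ q → pow t (suc n ∸ ascents q))
      ≡⟨ ≡.cong (λ qs → sumOver qs (λ q → pow t (suc n ∸ ascents q))) (perms-upTo-suc n) ⟩
    sumOver (concatMap (inserts 0) (map (map suc) ps)) (λ q → pow t (suc n ∸ ascents q))
      ≈⟨ sumOver-concatMap (inserts 0) (map (map suc) ps) _ ⟩
    sumOver (map (map suc) ps) (λ p → sumOver (inserts 0 p) (λ q → pow t (suc n ∸ ascents q)))
      ≡⟨ sumOver-map (map suc) ps _ ⟩
    sumOver ps (λ p → sumOver (inserts 0 (map suc p)) (λ q → pow t (suc n ∸ ascents q)))
      ≈⟨ sumOver-cong-All (perms-upTo-length n) (λ {p} → insertZero-pow n t p) ⟩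
    sumOver ps (λ p → fromℕ (suc n) * t * pow t (n ∸ ascents p) + (1# - t) * (fromℕ (n ∸ ascents p) * pow t (n ∸ ascents p)))
      ≈⟨ sumOver-distrib-+ ps _ _ ⟩
    sumOver ps (λ p → fromℕ (suc n) * t * pow t (n ∸ ascents p)) + sumOver ps (λ p → (1# - t) * (fromℕ (n ∸ ascents p) * pow t (n ∸ ascents p)))
      ≈⟨ +-cong (*-distribˡ-sumOver ps _ _) (*-distribˡ-sumOver ps _ _) ⟨
    fromℕ (suc n) * t * sumOver ps (λ p → pow t (n ∸ ascents p)) + (1# - t) * sumOver ps (λ p → fromℕ (n ∸ ascents p) * pow t (n ∸ ascents p))
      ≈⟨ +-cong (*-congˡ (eulerian-sumTo n (pow t))) (*-congˡ (eulerian-sumTo n (λ j → fromℕ j * pow t j))) ⟨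
    fromℕ (suc n) * t * eulerPoly n t + (1# - t) * eulerPolyθ n t ∎
    where
    ps : List (List ℕ)
    ps = perms (upTo n)

module PowerSums {c ℓ : Level} (R : CommutativeRing c ℓ) where
  open CommutativeRing R
  open RingOps R
  open IntegerSolver R
  open Appell R using (binom)
  open EulerianPolynomials R using (eulerPoly)

  -- eulerPoly n t / (1 - t)ⁿ⁺¹ for w an inverse of 1 - t: the regularised Σ_{k ≥ 0} kⁿ tᵏ.
  powerSum : ℕ → Carrier → Carrier → Carrier
  powerSum n t w = pow w (suc n) * eulerPoly n t

  δ₀ : ℕ → Carrier
  δ₀ zero    = 1#
  δ₀ (suc _) = 0#

  pow-0# : ∀ r → pow 0# r ≈ δ₀ r
  pow-0# zero    = refl
  pow-0# (suc r) = zeroˡ _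

  RecurrenceAt : ℕ → Carrier → (ℕ → Carrier) → Set ℓ
  RecurrenceAt r t X = X r - t * sumTo r (λ n → binom r n * X n) ≈ δ₀ r

  PowerSumRecurrence : ℕ → Set (c ⊔ ℓ)
  PowerSumRecurrence r = ∀ t w → w * (1# - t) ≈ 1# → RecurrenceAt r t (λ n → powerSum n t w)

  powerSumRecurrence-zero : PowerSumRecurrence 0
  powerSumRecurrence-zero t w w[1-t]≈1 = trans (solve 2 (λ t w →
      w :* :1 :* ((:1 :+ :0) :* :1)
        :- t :* ((:1 :+ :0) :* (w :* :1 :* ((:1 :+ :0) :* :1)))
      := w :* (:1 :- t)) refl t w) w[1-t]≈1

module DualNumbers {c ℓ : Level} (R : CommutativeRing c ℓ) where
  open CommutativeRing R
  open IntegerSolver R using (solve; _:+_; _:*_; _:=_; :0; :1)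

  -- Pairs (a , a′) stand for a + a′ε with ε² = 0.
  Dual : CommutativeRing c ℓ
  Dual = record
    { Carrier = Carrier × Carrier
    ; _≈_     = λ (a , a′) (b , b′) → a ≈ b × a′ ≈ b′
    ; _+_     = λ (a , a′) (b , b′) → a + b , a′ + b′
    ; _*_     = λ (a , a′) (b , b′) → a * b , a * b′ + a′ * b
    ; -_      = λ (a , a′) → - a , - a′
    ; 0#      = 0# , 0#
    ; 1#      = 1# , 0#
    ; isCommutativeRing = record
      { isRing = record
        { +-isAbelianGroup = record
          { isGroup = record
            { isMonoid = record
              { isSemigroup = record
                { isMagma = record
                  { isEquivalence = record
                    { refl  = refl , refl
                    ; sym   = λ (p , q) → sym p , sym q
                    ; trans = λ (p , q) (r , s) → trans p r , trans q s }
                  ; ∙-cong = λ (p , q) (r , s) → +-cong p r , +-cong q s }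
                ; assoc = λ _ _ _ → +-assoc _ _ _ , +-assoc _ _ _ }
              ; identity = (λ _ → +-identityˡ _ , +-identityˡ _) , (λ _ → +-identityʳ _ , +-identityʳ _) }
            ; inverse = (λ _ → -‿inverseˡ _ , -‿inverseˡ _) , (λ _ → -‿inverseʳ _ , -‿inverseʳ _)
            ; ⁻¹-cong = λ (p , q) → -‿cong p , -‿cong q }
          ; comm = λ _ _ → +-comm _ _ , +-comm _ _ }
        ; *-cong = λ (p , q) (r , s) → *-cong p r , +-cong (*-cong p s) (*-cong q r)
        ; *-assoc = λ (a , a′) (b , b′) (d , d′) → *-assoc _ _ _ ,
            solve 6 (λ a a′ b b′ d d′ → (a :* b) :* d′ :+ (a :* b′ :+ a′ :* b) :* d
                                      := a :* (b :* d′ :+ b′ :* d) :+ a′ :* (b :* d)) refl a a′ b b′ d d′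
        ; *-identity = (λ (a , a′) → *-identityˡ _ , solve 2 (λ a a′ → :1 :* a′ :+ :0 :* a := a′) refl a a′)
                     , (λ (a , a′) → *-identityʳ _ , solve 2 (λ a a′ → a :* :0 :+ a′ :* :1 := a′) refl a a′)
        ; distrib = (λ (a , a′) (b , b′) (d , d′) → distribˡ _ _ _ ,
                       solve 6 (λ a a′ b b′ d d′ → a :* (b′ :+ d′) :+ a′ :* (b :+ d)
                                                 := (a :* b′ :+ a′ :* b) :+ (a :* d′ :+ a′ :* d)) refl a a′ b b′ d d′)
                  , (λ (a , a′) (b , b′) (d , d′) → distribʳ _ _ _ ,
                       solve 6 (λ a a′ b b′ d d′ → (b :+ d) :* a′ :+ (b′ :+ d′) :* a
                                                 := (b :* a′ :+ b′ :* a) :+ (d :* a′ :+ d′ :* a)) refl a a′ b b′ d d′)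
        }
      ; *-comm = λ (a , a′) (b , b′) → *-comm _ _ , solve 4 (λ a a′ b b′ → a :* b′ :+ a′ :* b := b :* a′ :+ b′ :* a) refl a a′ b b′
      }
    }

module PowerSumDerivative {c ℓ : Level} (R : CommutativeRing c ℓ) where
  open CommutativeRing R
  open RingOps R
  open IntegerSolver R
  open RingSums R
  open Appell R using (binom; sumTo-pascal)
  open EulerianPolynomials R using (eulerPoly; eulerPolyθ; eulerPoly-suc)
  open PowerSums R
  open DualNumbers R using (Dual)
  open import Relation.Binary.Reasoning.Setoid setoid
  open import Algebra.Properties.CommutativeSemigroup *-commutativeSemigroup using (x∙yz≈y∙xz)

  module D where
    open CommutativeRing Dual public
    open RingOps Dual public
    open Appell Dual public using (binom)
    open EulerianPolynomials Dual public using (eulerPoly)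
    open PowerSums Dual public using (powerSum; δ₀; PowerSumRecurrence)

  proj₁-fromℕ : ∀ n → proj₁ (D.fromℕ n) ≡ fromℕ n
  proj₁-fromℕ zero    = ≡.refl
  proj₁-fromℕ (suc n) = ≡.cong (λ x → 1# + x) (proj₁-fromℕ n)

  proj₂-fromℕ : ∀ n → proj₂ (D.fromℕ n) ≈ 0#
  proj₂-fromℕ zero    = refl
  proj₂-fromℕ (suc n) = trans (+-congˡ (proj₂-fromℕ n)) (+-identityʳ 0#)

  proj₁-pow : ∀ x n → proj₁ (D.pow x n) ≡ pow (proj₁ x) n
  proj₁-pow x zero    = ≡.refl
  proj₁-pow x (suc n) = ≡.cong (proj₁ x *_) (proj₁-pow x n)

  proj₁-sumTo : ∀ n f → proj₁ (D.sumTo n f) ≡ sumTo n (proj₁ ∘ f)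
  proj₁-sumTo zero    f = ≡.refl
  proj₁-sumTo (suc n) f = ≡.cong (_+ proj₁ (f (suc n))) (proj₁-sumTo n f)

  proj₂-sumTo : ∀ n f → proj₂ (D.sumTo n f) ≡ sumTo n (proj₂ ∘ f)
  proj₂-sumTo zero    f = ≡.refl
  proj₂-sumTo (suc n) f = ≡.cong (_+ proj₂ (f (suc n))) (proj₂-sumTo n f)

  proj₁-fromℕ-* : ∀ k x → proj₁ (D.fromℕ k D.* x) ≈ fromℕ k * proj₁ x
  proj₁-fromℕ-* k x = *-congʳ (reflexive (proj₁-fromℕ k))

  proj₂-fromℕ-* : ∀ k x → proj₂ (D.fromℕ k D.* x) ≈ fromℕ k * proj₂ x
  proj₂-fromℕ-* k (x , x′) = begin
    proj₁ (D.fromℕ k) * x′ + proj₂ (D.fromℕ k) * x ≈⟨ +-cong (*-congʳ (reflexive (proj₁-fromℕ k))) (*-congʳ (proj₂-fromℕ k)) ⟩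
    fromℕ k * x′ + 0# * x                           ≈⟨ trans (+-congˡ (zeroˡ x)) (+-identityʳ _) ⟩
    fromℕ k * x′                                    ∎

  θ-pow : ∀ t j → t * proj₂ (D.pow (t , 1#) j) ≈ fromℕ j * pow t j
  θ-pow t zero    = trans (zeroʳ t) (sym (zeroˡ 1#))
  θ-pow t (suc j) = begin
    t * (t * proj₂ (D.pow (t , 1#) j) + 1# * proj₁ (D.pow (t , 1#) j))
      ≈⟨ *-congˡ (+-cong (θ-pow t j) (*-congˡ (reflexive (proj₁-pow (t , 1#) j)))) ⟩
    t * (fromℕ j * pow t j + 1# * pow t j)
      ≈⟨ solve 3 (λ t f p → t :* (f :* p :+ :1 :* p) := (:1 :+ f) :* (t :* p)) refl t (fromℕ j) (pow t j) ⟩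
    (1# + fromℕ j) * (t * pow t j) ∎

  -- (w , w²) is the dual number of w = (1 - t)⁻¹ when t carries derivative 1.
  ∂-pow-inverse : ∀ w m → proj₂ (D.pow (w , w * w) m) ≈ fromℕ m * pow w (suc m)
  ∂-pow-inverse w zero    = trans (sym (zeroˡ _)) (*-congʳ refl)
  ∂-pow-inverse w (suc m) = begin
    w * proj₂ (D.pow (w , w * w) m) + w * w * proj₁ (D.pow (w , w * w) m)
      ≈⟨ +-cong (*-congˡ (∂-pow-inverse w m)) (*-congˡ (reflexive (proj₁-pow (w , w * w) m))) ⟩
    w * (fromℕ m * (w * pow w m)) + w * w * pow w m
      ≈⟨ solve 3 (λ w f p → w :* (f :* (w :* p)) :+ w :* w :* p := (:1 :+ f) :* (w :* (w :* p))) refl w (fromℕ m) (pow w m) ⟩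
    (1# + fromℕ m) * (w * (w * pow w m)) ∎

  proj₁-eulerPoly : ∀ n x → proj₁ (D.eulerPoly n x) ≈ eulerPoly n (proj₁ x)
  proj₁-eulerPoly n x = trans (reflexive (proj₁-sumTo n _))
    (sumTo-cong n (λ j → trans (proj₁-fromℕ-* (eulerian n (n ℕ.∸ j)) (D.pow x j)) (*-congˡ (reflexive (proj₁-pow x j)))))

  θ-eulerPoly : ∀ n t → t * proj₂ (D.eulerPoly n (t , 1#)) ≈ eulerPolyθ n t
  θ-eulerPoly n t = begin
    t * proj₂ (D.eulerPoly n (t , 1#))
      ≡⟨ ≡.cong (t *_) (proj₂-sumTo n _) ⟩
    t * sumTo n (λ j → proj₂ (D.fromℕ (eulerian n (n ℕ.∸ j)) D.* D.pow (t , 1#) j))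
      ≈⟨ *-distribˡ-sumTo n t _ ⟩
    sumTo n (λ j → t * proj₂ (D.fromℕ (eulerian n (n ℕ.∸ j)) D.* D.pow (t , 1#) j))
      ≈⟨ sumTo-cong n (λ j → begin
           t * proj₂ (D.fromℕ (eulerian n (n ℕ.∸ j)) D.* D.pow (t , 1#) j)
             ≈⟨ *-congˡ (proj₂-fromℕ-* (eulerian n (n ℕ.∸ j)) _) ⟩
           t * (fromℕ (eulerian n (n ℕ.∸ j)) * proj₂ (D.pow (t , 1#) j))
             ≈⟨ x∙yz≈y∙xz t _ _ ⟩
           fromℕ (eulerian n (n ℕ.∸ j)) * (t * proj₂ (D.pow (t , 1#) j))
             ≈⟨ *-congˡ (θ-pow t j) ⟩
           fromℕ (eulerian n (n ℕ.∸ j)) * (fromℕ j * pow t j) ∎) ⟩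
    eulerPolyθ n t ∎

  proj₁-powerSum : ∀ n x y → proj₁ (D.powerSum n x y) ≈ powerSum n (proj₁ x) (proj₁ y)
  proj₁-powerSum n x y = *-cong (reflexive (proj₁-pow y (suc n))) (proj₁-eulerPoly n x)

  θ-powerSum : ∀ n t w → w * (1# - t) ≈ 1# → t * proj₂ (D.powerSum n (t , 1#) (w , w * w)) ≈ powerSum (suc n) t w
  θ-powerSum n t w w[1-t]≈1 = begin
    t * (proj₁ (D.pow W (suc n)) * proj₂ E + proj₂ (D.pow W (suc n)) * proj₁ E)
      ≈⟨ *-congˡ (+-cong (*-congʳ (reflexive (proj₁-pow W (suc n)))) (*-cong (∂-pow-inverse w (suc n)) (proj₁-eulerPoly n T))) ⟩
    t * (pow w (suc n) * proj₂ E + fromℕ (suc n) * (w * pow w (suc n)) * e)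
      ≈⟨ solve 6 (λ t p ∂e f w e → t :* (p :* ∂e :+ f :* (w :* p) :* e) := p :* (t :* ∂e) :+ w :* p :* (f :* t :* e)) refl t _ _ _ w e ⟩
    pow w (suc n) * (t * proj₂ E) + w * pow w (suc n) * (fromℕ (suc n) * t * e)
      ≈⟨ +-congʳ (*-cong (sym (trans (*-congʳ w[1-t]≈1) (*-identityˡ _))) (θ-eulerPoly n t)) ⟩
    w * (1# - t) * pow w (suc n) * eulerPolyθ n t + w * pow w (suc n) * (fromℕ (suc n) * t * e)
      ≈⟨ solve 6 (λ w t p θe f e → w :* (:1 :- t) :* p :* θe :+ w :* p :* (f :* t :* e) := w :* p :* (f :* t :* e :+ (:1 :- t) :* θe)) refl w t _ _ _ e ⟩
    w * pow w (suc n) * (fromℕ (suc n) * t * e + (1# - t) * eulerPolyθ n t)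
      ≈⟨ *-congˡ (eulerPoly-suc n t) ⟨
    powerSum (suc n) t w ∎
    where
    T W E : Carrier × Carrier
    T = (t , 1#)
    W = (w , w * w)
    E = D.eulerPoly n T
    e : Carrier
    e = eulerPoly n t

  inverse-dual : ∀ t w → w * (1# - t) ≈ 1# → (w , w * w) D.* (D.1# D.- (t , 1#)) D.≈ D.1#
  inverse-dual t w w[1-t]≈1 = w[1-t]≈1 , (begin
    w * (0# + - 1#) + w * w * (1# + - t) ≈⟨ solve 2 (λ w t → w :* (:0 :+ :- :1) :+ w :* w :* (:1 :+ :- t) := w :* (w :* (:1 :- t)) :- w) refl w t ⟩
    w * (w * (1# - t)) - w               ≈⟨ +-congʳ (trans (*-congˡ w[1-t]≈1) (*-identityʳ w)) ⟩
    w - w                                ≈⟨ -‿inverseʳ w ⟩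
    0#                                   ∎)

  proj₁-binomialSum : ∀ r x y → proj₁ (D.sumTo r (λ n → D.binom r n D.* D.powerSum n x y))
                                  ≈ sumTo r (λ n → binom r n * powerSum n (proj₁ x) (proj₁ y))
  proj₁-binomialSum r x y = trans (reflexive (proj₁-sumTo r _))
    (sumTo-cong r (λ n → trans (proj₁-fromℕ-* (r C n) (D.powerSum n x y)) (*-congˡ (proj₁-powerSum n x y))))

  θ-binomialSum : ∀ r t w → w * (1# - t) ≈ 1# →
    t * proj₂ (D.sumTo r (λ n → D.binom r n D.* D.powerSum n (t , 1#) (w , w * w)))
      ≈ sumTo r (λ n → binom r n * powerSum (suc n) t w)
  θ-binomialSum r t w w[1-t]≈1 = begin
    t * proj₂ (D.sumTo r (λ n → D.binom r n D.* D.powerSum n T W))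
      ≡⟨ ≡.cong (t *_) (proj₂-sumTo r _) ⟩
    t * sumTo r (λ n → proj₂ (D.binom r n D.* D.powerSum n T W))
      ≈⟨ *-distribˡ-sumTo r t _ ⟩
    sumTo r (λ n → t * proj₂ (D.binom r n D.* D.powerSum n T W))
      ≈⟨ sumTo-cong r (λ n → trans (*-congˡ (proj₂-fromℕ-* (r C n) _))
                              (trans (x∙yz≈y∙xz t _ _) (*-congˡ (θ-powerSum n t w w[1-t]≈1)))) ⟩
    sumTo r (λ n → binom r n * powerSum (suc n) t w) ∎
    where
    T W : Carrier × Carrier
    T = (t , 1#)
    W = (w , w * w)

  -- Applying θ = t d/dt to the recurrence at r turns it into the recurrence at r + 1.
  powerSumRecurrence-suc : ∀ r → D.PowerSumRecurrence r → PowerSumRecurrence (suc r)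
  powerSumRecurrence-suc r rec t w w[1-t]≈1 = begin
    powerSum (suc r) t w - t * sumTo (suc r) (λ n → binom (suc r) n * powerSum n t w)
      ≈⟨ +-congˡ (-‿cong (*-congˡ (sumTo-pascal r (λ n → powerSum n t w)))) ⟩
    powerSum (suc r) t w - t * (sumTo r (λ n → binom r n * powerSum n t w) + sumTo r (λ n → binom r n * powerSum (suc n) t w))
      ≈⟨ +-cong (θ-powerSum r t w w[1-t]≈1) (-‿cong (*-congˡ (+-cong (proj₁-binomialSum r T W) (θ-binomialSum r t w w[1-t]≈1)))) ⟨
    t * proj₂ (D.powerSum r T W) - t * (proj₁ Σ + t * proj₂ Σ)
      ≈⟨ solve 4 (λ t s a b → t :* s :- t :* (a :+ t :* b) := t :* ((s :+ :- (t :* b :+ :1 :* a)))) refl t _ _ _ ⟩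
    t * proj₂ (D.powerSum r T W D.- T D.* Σ)
      ≈⟨ *-congˡ (proj₂ (rec T W (inverse-dual t w w[1-t]≈1))) ⟩
    t * proj₂ (D.δ₀ r)
      ≈⟨ trans (*-congˡ (∂δ₀ r)) (zeroʳ t) ⟩
    0# ∎
    where
    T W Σ : Carrier × Carrier
    T = (t , 1#)
    W = (w , w * w)
    Σ = D.sumTo r (λ n → D.binom r n D.* D.powerSum n T W)
    ∂δ₀ : ∀ r → proj₂ (D.δ₀ r) ≈ 0#
    ∂δ₀ zero    = refl
    ∂δ₀ (suc r) = refl

powerSum-recurrence : ∀ r {c ℓ} (R : CommutativeRing c ℓ) → PowerSums.PowerSumRecurrence R r
powerSum-recurrence zero    R = PowerSums.powerSumRecurrence-zero R
powerSum-recurrence (suc r) R = PowerSumDerivative.powerSumRecurrence-suc R r (powerSum-recurrence r (DualNumbers.Dual R))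

IsApery : ∀ {k} → Vec ℕ k → (ℕ → ℕ) → Set
IsApery A m = ∀ i → 1 ≤ i → i < first A →
  0 < m i × (+ first A) ∣ℤ (+ m i ℤ.- + i) × InR A (m i) ×
  (∀ x → 0 < x → (+ first A) ∣ℤ (+ x ℤ.- + i) → InR A x → m i ≤ x)

dot-replicate-0 : ∀ {k} (B : Vec ℕ k) → dot (replicate k 0) B ≡ 0
dot-replicate-0 []      = ≡.refl
dot-replicate-0 (b ∷ B) = dot-replicate-0 B

∣+x-+y∣≡x∸y : ∀ {x y} → y ≤ x → ℤ.∣ + x ℤ.- + y ∣ ≡ x ∸ y
∣+x-+y∣≡x∸y {x} {y} y≤x = ≡.trans (≡.cong ℤ.∣_∣ (ℤ.m-n≡m⊖n x y)) (≡.trans (ℤ.∣m⊖n∣≡∣n⊖m∣ x y) (ℤ.∣⊖∣-≤ y≤x))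

∣+x-+y∣≡y∸x : ∀ {x y} → x < y → ℤ.∣ + x ℤ.- + y ∣ ≡ y ∸ x
∣+x-+y∣≡y∸x {x} {y} x<y = ≡.trans (≡.cong ℤ.∣_∣ (ℤ.m-n≡m⊖n x y)) (ℤ.∣⊖∣-< x<y)

module AperySet {k} (a : ℕ) .{{_ : NonZero a}} (A′ : Vec ℕ k)
                (m : ℕ → ℕ) (m0≡0 : m 0 ≡ 0) (apery : IsApery (a ∷ A′) m) where

  A : Vec ℕ (suc k)
  A = a ∷ A′

  Representable : ℕ → Set
  Representable n = ∃ λ x → n ≡ dot x A

  +-multiple-representable : ∀ n s → Representable n → Representable (n ℕ.+ s ℕ.* a)
  +-multiple-representable n s (x₀ ∷ xs , n≡xA) = (s ℕ.+ x₀) ∷ xs , (begin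
    n ℕ.+ s ℕ.* a                           ≡⟨ ≡.cong (ℕ._+ s ℕ.* a) n≡xA ⟩
    x₀ ℕ.* a ℕ.+ dot xs A′ ℕ.+ s ℕ.* a     ≡⟨ rotate (x₀ ℕ.* a) (dot xs A′) (s ℕ.* a) ⟩
    s ℕ.* a ℕ.+ x₀ ℕ.* a ℕ.+ dot xs A′     ≡⟨ ≡.cong (ℕ._+ dot xs A′) (ℕ.*-distribʳ-+ a s x₀) ⟨
    (s ℕ.+ x₀) ℕ.* a ℕ.+ dot xs A′         ∎)
    where
    open ≡.≡-Reasoning
    rotate : ∀ p q r → p ℕ.+ q ℕ.+ r ≡ r ℕ.+ p ℕ.+ q
    rotate = solve-∀

  m-representable : ∀ i → i < a → Representable (m i)
  m-representable zero    _   = replicate _ 0 , ≡.trans m0≡0 (≡.sym (dot-replicate-0 A))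
  m-representable (suc i) i<a = proj₂ (proj₁ (proj₂ (proj₂ (apery (suc i) (s≤s z≤n) i<a))))

  m-≡-mod : ∀ i → i < a → ∃ λ q → m i ≡ i ℕ.+ q ℕ.* a
  m-≡-mod zero    _   = 0 , m0≡0
  m-≡-mod (suc i) i<a with apery (suc i) (s≤s z≤n) i<a
  ... | _ , a∣mi-i , _ with suc i ℕ.≤? m (suc i)
  ...   | yes i≤mi = ℕ.quotient a∣ , ≡.sym (≡.trans (≡.cong (suc i ℕ.+_) (≡.sym (ℕ.m∣n⇒n≡quotient*m a∣))) (ℕ.m+[n∸m]≡n i≤mi))
    where
    a∣ : a ℕ.∣ m (suc i) ∸ suc i
    a∣ = ≡.subst (a ℕ.∣_) (∣+x-+y∣≡x∸y i≤mi) a∣mi-i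
  ...   | no  i≰mi = ⊥-elim (ℕ.<⇒≱ i<a (ℕ.≤-trans a≤i-mi (ℕ.m∸n≤m (suc i) (m (suc i)))))
    where
    mi<i : m (suc i) < suc i
    mi<i = ℕ.≰⇒> i≰mi
    a≤i-mi : a ≤ suc i ∸ m (suc i)
    a≤i-mi = ∣⇒≤ {{ℕ.>-nonZero (ℕ.m<n⇒0<n∸m mi<i)}} (≡.subst (a ℕ.∣_) (∣+x-+y∣≡y∸x mi<i) a∣mi-i)

  n≡n%a+[n/a]*a : ∀ n → n ≡ n % a ℕ.+ (n / a) ℕ.* a
  n≡n%a+[n/a]*a n = m≡m%n+[m/n]*n n a

  -- The representable numbers congruent to i are exactly m i, m i + a, m i + 2a, ….
  <m⇒NR : ∀ n → n < m (n % a) → InNR A n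
  <m⇒NR n n<m with n % a ℕ.≟ 0
  ... | yes i≡0 = ⊥-elim (ℕ.n≮0 (≡.subst (n <_) (≡.trans (≡.cong m i≡0) m0≡0) n<m))
  ... | no  i≢0 = 0<n , λ n∈R → ℕ.<⇒≱ n<m (minimal n 0<n a∣n-i n∈R)
    where
    i : ℕ
    i = n % a
    0<n : 0 < n
    0<n = ℕ.<-≤-trans (ℕ.n≢0⇒n>0 i≢0) (m%n≤m n a)
    minimal : ∀ x → 0 < x → (+ a) ∣ℤ (+ x ℤ.- + i) → InR A x → m i ≤ x
    minimal = proj₂ (proj₂ (proj₂ (apery i (ℕ.n≢0⇒n>0 i≢0) (m%n<n n a))))
    a∣n-i : (+ a) ∣ℤ (+ n ℤ.- + i)
    a∣n-i = ≡.subst (a ℕ.∣_) (≡.sym (∣+x-+y∣≡x∸y (m%n≤m n a)))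
              (divides (n / a) (≡.trans (≡.cong (_∸ i) (n≡n%a+[n/a]*a n)) (ℕ.m+n∸m≡n i _)))

  NR⇒<m : ∀ n → InNR A n → n < m (n % a)
  NR⇒<m n (0<n , n∉R) with n ℕ.<? m (n % a)
  ... | yes n<m = n<m
  ... | no  n≮m = ⊥-elim (n∉R (0<n , ≡.subst Representable (≡.sym n≡) (+-multiple-representable (m i) (n / a ∸ q) (m-representable i i<a))))
    where
    i q : ℕ
    i = n % a
    i<a : i < a
    i<a = m%n<n n a
    q = proj₁ (m-≡-mod i i<a)
    mi≡ : m i ≡ i ℕ.+ q ℕ.* a
    mi≡ = proj₂ (m-≡-mod i i<a)
    q≤n/a : q ≤ n / a
    q≤n/a = ℕ.*-cancelʳ-≤ q (n / a) a (ℕ.+-cancelˡ-≤ i _ _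
              (≡.subst₂ _≤_ mi≡ (n≡n%a+[n/a]*a n) (ℕ.≮⇒≥ n≮m)))
    n≡ : n ≡ m i ℕ.+ (n / a ∸ q) ℕ.* a
    n≡ = begin
      n                                          ≡⟨ n≡n%a+[n/a]*a n ⟩
      i ℕ.+ (n / a) ℕ.* a                        ≡⟨ ≡.cong (λ t → i ℕ.+ t ℕ.* a) (ℕ.m+[n∸m]≡n q≤n/a) ⟨
      i ℕ.+ (q ℕ.+ (n / a ∸ q)) ℕ.* a            ≡⟨ distr i q (n / a ∸ q) a ⟩
      i ℕ.+ q ℕ.* a ℕ.+ (n / a ∸ q) ℕ.* a        ≡⟨ ≡.cong (ℕ._+ (n / a ∸ q) ℕ.* a) mi≡ ⟨
      m i ℕ.+ (n / a ∸ q) ℕ.* a                  ∎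
      where
      open ≡.≡-Reasoning
      distr : ∀ i q r a → i ℕ.+ (q ℕ.+ r) ℕ.* a ≡ i ℕ.+ q ℕ.* a ℕ.+ r ℕ.* a
      distr = solve-∀

module NonRepresentableSum {c ℓ : Level} (R : CommutativeRing c ℓ) where
  open CommutativeRing R
  open RingOps R
  open IntegerSolver R
  open RingSums R
  open import Relation.Binary.Reasoning.Setoid setoid

  indicator-cong : ∀ {P Q : Set} (p? : Dec P) (q? : Dec Q) → (P → Q) → (Q → P) → indicator (does p?) ≈ indicator (does q?)
  indicator-cong (yes _) (yes _) _   _   = refl
  indicator-cong (yes p) (no ¬q) p→q _   = ⊥-elim (¬q (p→q p))
  indicator-cong (no ¬p) (yes q) _   q→p = ⊥-elim (¬p (q→p q))
  indicator-cong (no _)  (no _)  _   _   = refl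

  private
    indicator-∷ : ∀ {x n xs} (x≡n? : Dec (x ≡ n)) (n∈xs? : Dec (n ∈ xs)) (n∈x∷xs? : Dec (n ∈ x ∷ xs)) → x ∉ xs →
      indicator (does n∈x∷xs?) ≈ indicator (does x≡n?) + indicator (does n∈xs?)
    indicator-∷ (yes ≡.refl) (yes n∈xs) _            x∉xs = ⊥-elim (x∉xs n∈xs)
    indicator-∷ (yes ≡.refl) (no _)     (yes _)      _    = sym (+-identityʳ 1#)
    indicator-∷ (yes x≡n)    (no _)     (no n∉x∷xs)  _    = ⊥-elim (n∉x∷xs (here (≡.sym x≡n)))
    indicator-∷ {x} {n} {xs} (no x≢n) n∈xs? n∈x∷xs? _ = trans (indicator-cong n∈x∷xs? n∈xs? drop there) (sym (+-identityˡ _))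
      where
      drop : n ∈ x ∷ xs → n ∈ xs
      drop (here n≡x)  = ⊥-elim (x≢n (≡.sym n≡x))
      drop (there n∈xs) = n∈xs

  sumList-sumBelow : ∀ N (g : ℕ → Carrier) xs → Unique xs → All (_< N) xs →
    sumList xs g ≈ sumBelow N (λ n → indicator (does (n ∈? xs)) * g n)
  sumList-sumBelow N g []       []            []           = sym (sumBelow-zero N _ (λ _ _ → zeroˡ _))
  sumList-sumBelow N g (x ∷ xs) (x∉xs ∷ uxs) (x<N ∷ xs<N) = begin
    g x + sumList xs g
      ≈⟨ +-cong (sym (sumBelow-indicator N x g x<N)) (sumList-sumBelow N g xs uxs xs<N) ⟩
    sumBelow N (λ n → indicator (x ℕ.≡ᵇ n) * g n) + sumBelow N (λ n → indicator (does (n ∈? xs)) * g n)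
      ≈⟨ sumBelow-distrib-+ N _ _ ⟨
    sumBelow N (λ n → indicator (x ℕ.≡ᵇ n) * g n + indicator (does (n ∈? xs)) * g n)
      ≈⟨ sumBelow-cong< N (λ n _ → trans (sym (distribʳ _ _ _)) (*-congʳ (sym (indicator-∷ (x ℕ.≟ n) (n ∈? xs) (n ∈? (x ∷ xs)) x∉xs′)))) ⟩
    sumBelow N (λ n → indicator (does (n ∈? (x ∷ xs))) * g n) ∎
    where
    x∉xs′ : x ∉ xs
    x∉xs′ = All.All¬⇒¬Any x∉xs

  sumBelow-telescope : ∀ n (G : ℕ → Carrier) → sumBelow n (λ t → G (suc t) - G t) ≈ G n - G 0
  sumBelow-telescope zero    G = sym (-‿inverseʳ (G 0))
  sumBelow-telescope (suc n) G = trans (+-congʳ (sumBelow-telescope n G))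
    (solve 3 (λ a b c → (a :- c) :+ (b :- a) := b :- c) refl (G n) (G (suc n)) (G 0))

  sumBelow-truncate : ∀ q M (h : ℕ → Carrier) → q ≤ M → sumBelow M (λ t → indicator (does (t ℕ.<? q)) * h t) ≈ sumBelow q h
  sumBelow-truncate q M h q≤M = begin
    sumBelow M f                                         ≡⟨ ≡.cong (λ k → sumBelow k f) (ℕ.m+[n∸m]≡n q≤M) ⟨
    sumBelow (q ℕ.+ (M ∸ q)) f                           ≈⟨ sumBelow-+ q (M ∸ q) f ⟩
    sumBelow q f + sumBelow (M ∸ q) (λ j → f (q ℕ.+ j))  ≈⟨ +-cong (sumBelow-cong< q kept) (sumBelow-zero (M ∸ q) _ dropped) ⟩
    sumBelow q h + 0#                                    ≈⟨ +-identityʳ _ ⟩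
    sumBelow q h                                         ∎
    where
    f : ℕ → Carrier
    f t = indicator (does (t ℕ.<? q)) * h t
    kept : ∀ t → t < q → f t ≈ h t
    kept t t<q = trans (*-congʳ (indicator-cong (t ℕ.<? q) (yes t<q) (λ _ → t<q) (λ x → x))) (*-identityˡ _)
    dropped : ∀ j → j < M ∸ q → f (q ℕ.+ j) ≈ 0#
    dropped j _ = trans (*-congʳ (indicator-cong (q ℕ.+ j ℕ.<? q) (no (ℕ.m+n≮m q j)) (λ x → x) (λ x → x))) (zeroˡ _)

  module _ {k} (a′ : ℕ) (A′ : Vec ℕ k) (m : ℕ → ℕ) (m0≡0 : m 0 ≡ 0) (apery : IsApery (suc a′ ∷ A′) m)
           (F g : ℕ → Carrier) (F-step : ∀ y → F (y ℕ.+ suc a′) - F y ≈ g y) where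
    private
      a : ℕ
      a = suc a′
      open AperySet a A′ m m0≡0 apery

      maxBelow : ℕ → ℕ
      maxBelow zero    = 0
      maxBelow (suc n) = maxBelow n ℕ.⊔ m n

      m≤maxBelow : ∀ {i n} → i < n → m i ≤ maxBelow n
      m≤maxBelow {i} {suc n} i<1+n with i ℕ.≟ n
      ... | yes ≡.refl = ℕ.m≤n⊔m (maxBelow i) (m i)
      ... | no  i≢n    = ℕ.m≤n⇒m≤n⊔o (m n) (m≤maxBelow (ℕ.≤∧≢⇒< (ℕ.≤-pred i<1+n) i≢n))

      M : ℕ
      M = suc (maxBelow a)

      inResidueClass : ℕ → ℕ → Carrier
      inResidueClass i t = indicator (does (i ℕ.+ t ℕ.* a ℕ.<? m ((i ℕ.+ t ℕ.* a) % a))) * g (i ℕ.+ t ℕ.* a)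

      indicator-residue : ∀ {i q} t → i < a → m i ≡ i ℕ.+ q ℕ.* a →
        indicator (does (i ℕ.+ t ℕ.* a ℕ.<? m ((i ℕ.+ t ℕ.* a) % a))) ≈ indicator (does (t ℕ.<? q))
      indicator-residue {i} {q} t i<a mi≡ = begin
        indicator (does (i ℕ.+ t ℕ.* a ℕ.<? m ((i ℕ.+ t ℕ.* a) % a)))
          ≡⟨ ≡.cong (λ x → indicator (does (i ℕ.+ t ℕ.* a ℕ.<? x))) (≡.trans (≡.cong m residue) mi≡) ⟩
        indicator (does (i ℕ.+ t ℕ.* a ℕ.<? i ℕ.+ q ℕ.* a))
          ≈⟨ indicator-cong (i ℕ.+ t ℕ.* a ℕ.<? i ℕ.+ q ℕ.* a) (t ℕ.<? q)
               (λ lt → ℕ.*-cancelʳ-< a t q (ℕ.+-cancelˡ-< i _ _ lt)) (λ t<q → ℕ.+-monoʳ-< i (ℕ.*-monoˡ-< a t<q)) ⟩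
        indicator (does (t ℕ.<? q)) ∎
        where
        residue : (i ℕ.+ t ℕ.* a) % a ≡ i
        residue = ≡.trans ([m+kn]%n≡m%n i t a) (m<n⇒m%n≡m i<a)

      residueClass : ∀ i → i < a → sumBelow M (inResidueClass i) ≈ F (m i) - F i
      residueClass i i<a with m-≡-mod i i<a
      ... | q , mi≡ = begin
        sumBelow M (inResidueClass i)
          ≈⟨ sumBelow-cong< M (λ t _ → *-congʳ (indicator-residue {q = q} t i<a mi≡)) ⟩
        sumBelow M (λ t → indicator (does (t ℕ.<? q)) * g (i ℕ.+ t ℕ.* a))
          ≈⟨ sumBelow-truncate q M _ q≤M ⟩
        sumBelow q (λ t → g (i ℕ.+ t ℕ.* a))
          ≈⟨ sumBelow-cong< q (λ t _ → trans (sym (F-step (i ℕ.+ t ℕ.* a))) (+-congʳ (reflexive (≡.cong F (shift t))))) ⟩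
        sumBelow q (λ t → F (i ℕ.+ suc t ℕ.* a) - F (i ℕ.+ t ℕ.* a))
          ≈⟨ sumBelow-telescope q (λ t → F (i ℕ.+ t ℕ.* a)) ⟩
        F (i ℕ.+ q ℕ.* a) - F (i ℕ.+ 0)
          ≡⟨ ≡.cong₂ (λ x y → F x - F y) (≡.sym mi≡) (ℕ.+-identityʳ i) ⟩
        F (m i) - F i ∎
        where
        q≤M : q ≤ M
        q≤M = ℕ.m≤n⇒m≤1+n (ℕ.≤-trans (ℕ.m≤m*n q a) (ℕ.≤-trans (ℕ.m≤n+m (q ℕ.* a) i)
                (ℕ.≤-trans (ℕ.≤-reflexive (≡.sym mi≡)) (m≤maxBelow i<a))))
        shift : ∀ t → i ℕ.+ t ℕ.* a ℕ.+ a ≡ i ℕ.+ suc t ℕ.* a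
        shift t = ≡.trans (ℕ.+-assoc i (t ℕ.* a) a) (≡.cong (i ℕ.+_) (ℕ.+-comm (t ℕ.* a) a))

    sumList-NR : (NR : List ℕ) → Unique NR → (∀ n → (n ∈ NR) ⇔ InNR A n) →
      sumList NR g ≈ sumTo a′ (λ i → F (m i) - F i)
    sumList-NR NR NR-unique NR⇔ = begin
      sumList NR g
        ≈⟨ sumList-sumBelow (M ℕ.* a) g NR NR-unique bounded ⟩
      sumBelow (M ℕ.* a) (λ n → indicator (does (n ∈? NR)) * g n)
        ≈⟨ sumBelow-cong< (M ℕ.* a) (λ n _ → *-congʳ (indicator-cong (n ∈? NR) (n ℕ.<? m (n % a))
             (λ n∈NR → NR⇒<m n (Equivalence.to (NR⇔ n) n∈NR)) (λ n<m → Equivalence.from (NR⇔ n) (<m⇒NR n n<m)))) ⟩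
      sumBelow (M ℕ.* a) (λ n → indicator (does (n ℕ.<? m (n % a))) * g n)
        ≈⟨ sumBelow-* M a _ ⟩
      sumBelow M (λ t → sumBelow a (λ i → inResidueClass i t))
        ≈⟨ sumBelow-comm M a _ ⟩
      sumBelow a (λ i → sumBelow M (inResidueClass i))
        ≈⟨ sumBelow-cong< a residueClass ⟩
      sumBelow a (λ i → F (m i) - F i)
        ≈⟨ sumBelow-suc a′ _ ⟩
      sumTo a′ (λ i → F (m i) - F i) ∎
      where
      bounded : All (_< M ℕ.* a) NR
      bounded = All.tabulate (λ {n} n∈NR → ℕ.<-≤-trans
        (ℕ.<-≤-trans (NR⇒<m n (Equivalence.to (NR⇔ n) n∈NR)) (ℕ.m≤n⇒m≤1+n (m≤maxBelow (m%n<n n a))))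
        (ℕ.m≤m*n M a))

module PowerSumPolynomials {c ℓ : Level} (R : CommutativeRing c ℓ) where
  open CommutativeRing R
  open RingOps R
  open IntegerSolver R
  open RingSums R
  open Appell R
  open PowerSums R
  open import Relation.Binary.Reasoning.Setoid setoid
  open import Algebra.Properties.CommutativeSemigroup *-commutativeSemigroup using (x∙yz≈y∙xz)
  open import Algebra.Properties.AbelianGroup +-abelianGroup using (⁻¹-involutive)

  SatisfiesRecurrence : Carrier → (ℕ → Carrier) → Set ℓ
  SatisfiesRecurrence t X = ∀ r → RecurrenceAt r t X

  powerSum-satisfiesRecurrence : ∀ t w → w * (1# - t) ≈ 1# → SatisfiesRecurrence t (λ n → powerSum n t w)
  powerSum-satisfiesRecurrence t w w[1-t]≈1 r = powerSum-recurrence r R t w w[1-t]≈1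

  private
    solveRecurrence : ∀ t w → w * (1# - t) ≈ 1# → ∀ X → SatisfiesRecurrence t X →
      ∀ r → X r ≈ w * (δ₀ r + t * sumBelow r (λ n → binom r n * X n))
    solveRecurrence t w w[1-t]≈1 X rec r = begin
      X r                                    ≈⟨ trans (*-congˡ w[1-t]≈1) (*-identityʳ _) ⟨
      X r * (w * (1# - t))                   ≈⟨ solve 4 (λ x w t b → x :* (w :* (:1 :- t)) := w :* ((x :- t :* (b :+ x)) :+ t :* b)) refl (X r) w t B ⟩
      w * ((X r - t * (B + X r)) + t * B)    ≈⟨ *-congˡ (+-congʳ (trans (+-congˡ (-‿cong (*-congˡ split))) (rec r))) ⟩
      w * (δ₀ r + t * B)                     ∎
      where
      B : Carrier
      B = sumBelow r (λ n → binom r n * X n)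
      split : B + X r ≈ sumTo r (λ n → binom r n * X n)
      split = begin
        B + X r                        ≈⟨ +-congˡ (*-identityˡ (X r)) ⟨
        B + 1# * X r                   ≈⟨ +-congˡ (*-congʳ (trans (sym (+-identityʳ 1#)) (reflexive (≡.cong fromℕ (≡.sym (nCn≡1 r)))))) ⟩
        B + binom r r * X r            ≈⟨ sumBelow-suc r _ ⟩
        sumTo r (λ n → binom r n * X n) ∎

  recurrence-unique : ∀ t w → w * (1# - t) ≈ 1# → ∀ X Y → SatisfiesRecurrence t X → SatisfiesRecurrence t Y → ∀ r → X r ≈ Y r
  recurrence-unique t w w[1-t]≈1 X Y recX recY = <-rec _ step
    where
    step : ∀ r → (∀ {j} → j < r → X j ≈ Y j) → X r ≈ Y r
    step r ih = begin
      X r                                                      ≈⟨ solveRecurrence t w w[1-t]≈1 X recX r ⟩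
      w * (δ₀ r + t * sumBelow r (λ n → binom r n * X n))      ≈⟨ *-congˡ (+-congˡ (*-congˡ (sumBelow-cong< r (λ j j<r → *-congˡ (ih j<r))))) ⟩
      w * (δ₀ r + t * sumBelow r (λ n → binom r n * Y n))      ≈⟨ solveRecurrence t w w[1-t]≈1 Y recY r ⟨
      Y r                                                      ∎

  private
    sumTo-δ₀ : ∀ n (f : ℕ → Carrier) → sumTo n (λ j → δ₀ j * f j) ≈ f 0
    sumTo-δ₀ zero    f = *-identityˡ (f 0)
    sumTo-δ₀ (suc n) f = begin
      sumTo (suc n) (λ j → δ₀ j * f j)              ≈⟨ sumTo-suc n _ ⟩
      1# * f 0 + sumTo n (λ j → 0# * f (suc j))     ≈⟨ +-cong (*-identityˡ _) (sumTo-zero n _ (λ j _ → zeroˡ _)) ⟩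
      f 0 + 0#                                      ≈⟨ +-identityʳ _ ⟩
      f 0                                           ∎

  -- Formally Q μ X = Σ_{k ≥ 0} Λᵏ (X + k a)^μ, the solution of Q(X) - Λ Q(X + a) = X^μ.
  module DifferenceEquation (a : ℕ) (Λ w : Carrier) (w[1-Λ]≈1 : w * (1# - Λ) ≈ 1#) where

    coeff : ℕ → Carrier
    coeff n = pow (fromℕ a) n * powerSum n Λ w

    Q : ℕ → Carrier → Carrier
    Q = appell coeff

    Q-cong : ∀ μ {X Y} → X ≈ Y → Q μ X ≈ Q μ Y
    Q-cong μ X≈Y = sumTo-cong μ (λ n → *-congˡ (*-congˡ (pow-cong (μ ∸ n) X≈Y)))

    private
      A : Carrier
      A = fromℕ a

      appell-coeff-a : ∀ j → appell coeff j A ≈ pow A j * sumTo j (λ n → binom j n * powerSum n Λ w)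
      appell-coeff-a j = begin
        sumTo j (λ n → binom j n * (pow A n * powerSum n Λ w * pow A (j ∸ n)))
          ≈⟨ sumTo-cong≤ j (λ n n≤j → begin
               binom j n * (pow A n * powerSum n Λ w * pow A (j ∸ n))
                 ≈⟨ solve 4 (λ b p s q → b :* (p :* s :* q) := (p :* q) :* (b :* s)) refl _ _ _ _ ⟩
               (pow A n * pow A (j ∸ n)) * (binom j n * powerSum n Λ w)
                 ≈⟨ *-congʳ (trans (sym (pow-+ A n (j ∸ n))) (reflexive (≡.cong (pow A) (ℕ.m+[n∸m]≡n n≤j)))) ⟩
               pow A j * (binom j n * powerSum n Λ w) ∎) ⟩
        sumTo j (λ n → pow A j * (binom j n * powerSum n Λ w))
          ≈⟨ *-distribˡ-sumTo j _ _ ⟨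
        pow A j * sumTo j (λ n → binom j n * powerSum n Λ w) ∎

      Λ-shift-term : ∀ μ X j → Λ * (binom μ j * (appell coeff j A * pow X (μ ∸ j)))
        ≈ binom μ j * (coeff j * pow X (μ ∸ j)) - δ₀ j * (binom μ j * (pow A j * pow X (μ ∸ j)))
      Λ-shift-term μ X j = begin
        Λ * (binom μ j * (appell coeff j A * pow X (μ ∸ j)))
          ≈⟨ *-congˡ (*-congˡ (*-congʳ (appell-coeff-a j))) ⟩
        Λ * (binom μ j * (pow A j * Σ * pow X (μ ∸ j)))
          ≈⟨ solve 5 (λ l b p s x → l :* (b :* (p :* s :* x)) := b :* (p :* (l :* s) :* x)) refl Λ _ _ Σ _ ⟩
        binom μ j * (pow A j * (Λ * Σ) * pow X (μ ∸ j))
          ≈⟨ *-congˡ (*-congʳ (*-congˡ ΛΣ≈S-δ)) ⟩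
        binom μ j * (pow A j * (powerSum j Λ w - δ₀ j) * pow X (μ ∸ j))
          ≈⟨ solve 5 (λ b p s d x → b :* (p :* (s :- d) :* x) := b :* (p :* s :* x) :- d :* (b :* (p :* x))) refl _ _ _ _ _ ⟩
        binom μ j * (coeff j * pow X (μ ∸ j)) - δ₀ j * (binom μ j * (pow A j * pow X (μ ∸ j))) ∎
        where
        Σ : Carrier
        Σ = sumTo j (λ n → binom j n * powerSum n Λ w)
        ΛΣ≈S-δ : Λ * Σ ≈ powerSum j Λ w - δ₀ j
        ΛΣ≈S-δ = trans (solve 2 (λ s y → y := s :- (s :- y)) refl (powerSum j Λ w) (Λ * Σ))
                       (+-congˡ (-‿cong (powerSum-satisfiesRecurrence Λ w w[1-Λ]≈1 j)))

    Q-difference : ∀ μ X → Q μ X - Λ * Q μ (X + A) ≈ pow X μ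
    Q-difference μ X = begin
      Q μ X - Λ * Q μ (X + A)
        ≈⟨ +-congˡ (-‿cong (*-congˡ (trans (Q-cong μ (+-comm X A)) (appell-+ coeff μ A X)))) ⟩
      Q μ X - Λ * sumTo μ (λ j → binom μ j * (appell coeff j A * pow X (μ ∸ j)))
        ≈⟨ +-congˡ (-‿cong (trans (*-distribˡ-sumTo μ Λ _) (sumTo-cong μ (Λ-shift-term μ X)))) ⟩
      Q μ X - sumTo μ (λ j → binom μ j * (coeff j * pow X (μ ∸ j)) - δ₀ j * (binom μ j * (pow A j * pow X (μ ∸ j))))
        ≈⟨ +-congˡ (-‿cong (trans (sumTo-distrib-minus μ _ _) (+-congˡ (-‿cong (sumTo-δ₀ μ _))))) ⟩
      Q μ X - (Q μ X - binom μ 0 * (1# * pow X μ))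
        ≈⟨ solve 2 (λ q x → q :- (q :- (:1 :+ :0) :* (:1 :* x)) := x) refl (Q μ X) (pow X μ) ⟩
      pow X μ ∎

    Q-shift : ∀ r X → sumTo r (λ n → binom r n * Q n X) ≈ Q r (X + 1#)
    Q-shift r X = sym (trans (appell-+ coeff r X 1#)
      (sumTo-cong r (λ j → *-congˡ (trans (*-congˡ (pow-1# (r ∸ j))) (*-identityʳ _)))))

  module PowerWeightedSums (a′ : ℕ) (lam w v : Carrier)
      (w[1-Λ]≈1 : w * (1# - pow lam (suc a′)) ≈ 1#) (v[1-λ]≈1 : v * (1# - lam) ≈ 1#) where
    open DifferenceEquation (suc a′) (pow lam (suc a′)) w w[1-Λ]≈1 public

    F : ℕ → ℕ → Carrier
    F μ x = - (pow lam x * Q μ (fromℕ x))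

    F-step : ∀ μ y → F μ (y ℕ.+ suc a′) - F μ y ≈ pow lam y * fromℕ (y ℕ.^ μ)
    F-step μ y = begin
      - (pow lam (y ℕ.+ suc a′) * Q μ (fromℕ (y ℕ.+ suc a′))) - - (pow lam y * Q μ (fromℕ y))
        ≈⟨ +-congʳ (-‿cong (*-cong (pow-+ lam y (suc a′)) (Q-cong μ (fromℕ-+ y (suc a′))))) ⟩
      - (pow lam y * pow lam (suc a′) * Q μ (fromℕ y + fromℕ (suc a′))) - - (pow lam y * Q μ (fromℕ y))
        ≈⟨ solve 4 (λ p l q₁ q₀ → :- (p :* l :* q₁) :- (:- (p :* q₀)) := p :* (q₀ :- l :* q₁)) refl _ _ _ _ ⟩
      pow lam y * (Q μ (fromℕ y) - pow lam (suc a′) * Q μ (fromℕ y + fromℕ (suc a′)))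
        ≈⟨ *-congˡ (trans (Q-difference μ (fromℕ y)) (sym (fromℕ-^ y μ))) ⟩
      pow lam y * fromℕ (y ℕ.^ μ) ∎

    L : ℕ → Carrier
    L r = sumTo a′ (λ i → pow lam i * Q r (fromℕ i))

    L-shift : ∀ r → sumTo r (λ n → binom r n * L n) ≈ sumTo a′ (λ i → pow lam i * Q r (fromℕ i + 1#))
    L-shift r = begin
      sumTo r (λ n → binom r n * sumTo a′ (λ i → pow lam i * Q n (fromℕ i)))
        ≈⟨ sumTo-cong r (λ n → *-distribˡ-sumTo a′ _ _) ⟩
      sumTo r (λ n → sumTo a′ (λ i → binom r n * (pow lam i * Q n (fromℕ i))))
        ≈⟨ sumTo-comm r a′ _ ⟩
      sumTo a′ (λ i → sumTo r (λ n → binom r n * (pow lam i * Q n (fromℕ i))))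
        ≈⟨ sumTo-cong a′ (λ i → trans (sumTo-cong r (λ n → x∙yz≈y∙xz _ _ _)) (sym (*-distribˡ-sumTo r _ _))) ⟩
      sumTo a′ (λ i → pow lam i * sumTo r (λ n → binom r n * Q n (fromℕ i)))
        ≈⟨ sumTo-cong a′ (λ i → *-congˡ (Q-shift r (fromℕ i))) ⟩
      sumTo a′ (λ i → pow lam i * Q r (fromℕ i + 1#)) ∎

    -- Multiplying by λ shifts the sum over i by one; the two boundary terms cancel by the difference
    -- equation at X = 0.
    L-satisfiesRecurrence : SatisfiesRecurrence lam L
    L-satisfiesRecurrence r = begin
      L r - lam * sumTo r (λ n → binom r n * L n)
        ≈⟨ +-congˡ (-‿cong (*-congˡ (L-shift r))) ⟩
      L r - lam * sumTo a′ (λ i → pow lam i * Q r (fromℕ i + 1#))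
        ≈⟨ +-congˡ (-‿cong (trans (*-distribˡ-sumTo a′ lam _)
             (sumTo-cong a′ (λ i → trans (sym (*-assoc _ _ _)) (*-congˡ (Q-cong r (+-comm _ _))))))) ⟩
      L r - sumTo a′ (λ i → f (suc i))
        ≈⟨ +-congˡ (-‿cong (solve 2 (λ x y → x := y :+ x :- y) refl _ (f 0))) ⟩
      L r - (f 0 + sumTo a′ (λ i → f (suc i)) - f 0)
        ≈⟨ +-congˡ (-‿cong (+-congʳ (sumTo-suc a′ f))) ⟨
      L r - (L r + f (suc a′) - f 0)
        ≈⟨ solve 3 (λ l x y → l :- (l :+ x :- y) := y :- x) refl (L r) (f (suc a′)) (f 0) ⟩
      f 0 - f (suc a′)
        ≈⟨ +-cong (*-identityˡ _) (-‿cong (*-congˡ (Q-cong r (sym (+-identityˡ _))))) ⟩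
      Q r 0# - pow lam (suc a′) * Q r (0# + fromℕ (suc a′))
        ≈⟨ Q-difference r 0# ⟩
      pow 0# r
        ≈⟨ pow-0# r ⟩
      δ₀ r ∎
      where
      f : ℕ → Carrier
      f i = pow lam i * Q r (fromℕ i)

    L≈powerSum : ∀ r → L r ≈ powerSum r lam v
    L≈powerSum = recurrence-unique lam v v[1-λ]≈1 L (λ r → powerSum r lam v)
                   L-satisfiesRecurrence (powerSum-satisfiesRecurrence lam v v[1-λ]≈1)

    F-sum-initial : ∀ μ → - sumTo a′ (λ i → F μ i) ≈ powerSum μ lam v
    F-sum-initial μ = begin
      - sumTo a′ (λ i → - (pow lam i * Q μ (fromℕ i))) ≈⟨ -‿cong (sumTo-neg a′ _) ⟩
      - - L μ                                           ≈⟨ ⁻¹-involutive (L μ) ⟩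
      L μ                                               ≈⟨ L≈powerSum μ ⟩
      powerSum μ lam v                                  ∎

    F-sum : ∀ μ (x : ℕ → ℕ) N → sumTo N (λ i → F μ (x i))
      ≈ sumTo μ (λ n → - (binom μ n * coeff n) * sumTo N (λ i → fromℕ (x i ℕ.^ (μ ∸ n)) * pow lam (x i)))
    F-sum μ x N = sym (begin
      sumTo μ (λ n → - (binom μ n * coeff n) * sumTo N (λ i → fromℕ (x i ℕ.^ (μ ∸ n)) * pow lam (x i)))
        ≈⟨ sumTo-cong μ (λ n → *-distribˡ-sumTo N _ _) ⟩
      sumTo μ (λ n → sumTo N (λ i → - (binom μ n * coeff n) * (fromℕ (x i ℕ.^ (μ ∸ n)) * pow lam (x i))))
        ≈⟨ sumTo-comm μ N _ ⟩
      sumTo N (λ i → sumTo μ (λ n → - (binom μ n * coeff n) * (fromℕ (x i ℕ.^ (μ ∸ n)) * pow lam (x i))))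
        ≈⟨ sumTo-cong N (λ i → sumTo-cong μ (λ n → trans (*-congˡ (*-congʳ (fromℕ-^ (x i) (μ ∸ n))))
             (solve 4 (λ b s y l → (:- (b :* s)) :* (y :* l) := :- (l :* (b :* (s :* y)))) refl _ _ _ _))) ⟩
      sumTo N (λ i → sumTo μ (λ n → - (pow lam (x i) * (binom μ n * (coeff n * pow (fromℕ (x i)) (μ ∸ n))))))
        ≈⟨ sumTo-cong N (λ i → trans (sumTo-neg μ _) (-‿cong (sym (*-distribˡ-sumTo μ _ _)))) ⟩
      sumTo N (λ i → F μ (x i)) ∎)

module NonRepresentablePowerSum {c ℓ : Level} (R : CommutativeRing c ℓ) where
  open CommutativeRing R
  open RingOps R
  open IntegerSolver R
  open RingSums R
  open Appell R using (binom)
  open EulerianPolynomials R using (eulerPoly)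
  open PowerSums R using (powerSum)
  open PowerSumPolynomials R
  open NonRepresentableSum R
  open import Relation.Binary.Reasoning.Setoid setoid

  pow-neg : ∀ x n → pow (- x) n ≈ pow (- 1#) n * pow x n
  pow-neg x n = trans (pow-cong n (sym (-1*x≈-x x))) (pow-distrib-* (- 1#) x n)
    where open import Algebra.Properties.Ring ring using (-1*x≈-x)

  negate-inverse : ∀ {w x} → w * (x - 1#) ≈ 1# → (- w) * (1# - x) ≈ 1#
  negate-inverse {w} {x} = trans (solve 2 (λ w x → (:- w) :* (:1 :- x) := w :* (x :- :1)) refl w x)

  module _ (a′ : ℕ) (lam u v : Carrier) (u[Λ-1]≈1 : u * (pow lam (suc a′) - 1#) ≈ 1#) (v[λ-1]≈1 : v * (lam - 1#) ≈ 1#) where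
    open PowerWeightedSums a′ lam (- u) (- v) (negate-inverse u[Λ-1]≈1) (negate-inverse v[λ-1]≈1)

    coeff≈ : ∀ μ n → pow (- fromℕ (suc a′)) n * pow u (suc n) * fromℕ (μ C n)
                       * sumTo n (λ j → fromℕ (eulerian n (n ∸ j)) * pow lam (j ℕ.* suc a′))
                     ≈ - (binom μ n * coeff n)
    coeff≈ μ n = begin
      pow (- fromℕ a) n * pow u (suc n) * binom μ n * sumTo n (λ j → fromℕ (eulerian n (n ∸ j)) * pow lam (j ℕ.* a))
        ≈⟨ *-cong (*-congʳ (*-congʳ (pow-neg (fromℕ a) n))) (sumTo-cong n (λ j → *-congˡ (pow-* lam j a))) ⟩
      pow (- 1#) n * pow (fromℕ a) n * pow u (suc n) * binom μ n * eulerPoly n (pow lam a)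
        ≈⟨ solve 5 (λ s p q b e → s :* p :* q :* b :* e := :- (b :* (p :* ((:- :1 :* s) :* q :* e)))) refl _ _ _ _ _ ⟩
      - (binom μ n * (pow (fromℕ a) n * ((- 1# * pow (- 1#) n) * pow u (suc n) * eulerPoly n (pow lam a))))
        ≈⟨ -‿cong (*-congˡ (*-congˡ (*-congʳ (pow-neg u (suc n))))) ⟨
      - (binom μ n * coeff n) ∎
      where
      a : ℕ
      a = suc a′

    sumList-NR-powers : ∀ {k} (A′ : Vec ℕ k) (m : ℕ → ℕ) → m 0 ≡ 0 → IsApery (suc a′ ∷ A′) m →
      (NR : List ℕ) → Unique NR → (∀ n → (n ∈ NR) ⇔ InNR (suc a′ ∷ A′) n) → ∀ μ →
      sumList NR (λ n → pow lam n * fromℕ (n ℕ.^ μ))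
        ≈
      sumTo μ (λ n →
          pow (- fromℕ (suc a′)) n * pow u (suc n) * fromℕ (μ C n)
          * sumTo n (λ j → fromℕ (eulerian n (n ∸ j)) * pow lam (j ℕ.* suc a′))
          * sumTo a′ (λ i → fromℕ (m i ℕ.^ (μ ∸ n)) * pow lam (m i)))
      + pow (- 1#) (suc μ) * pow v (suc μ)
        * sumTo μ (λ j → fromℕ (eulerian μ (μ ∸ j)) * pow lam j)
    sumList-NR-powers A′ m m0≡0 apery NR NR-unique NR⇔ μ = begin
      sumList NR (λ n → pow lam n * fromℕ (n ℕ.^ μ))
        ≈⟨ sumList-NR a′ A′ m m0≡0 apery (F μ) _ (F-step μ) NR NR-unique NR⇔ ⟩
      sumTo a′ (λ i → F μ (m i) - F μ i)
        ≈⟨ sumTo-distrib-minus a′ _ _ ⟩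
      sumTo a′ (λ i → F μ (m i)) - sumTo a′ (λ i → F μ i)
        ≈⟨ +-cong (F-sum μ m a′) (F-sum-initial μ) ⟩
      sumTo μ (λ n → - (binom μ n * coeff n) * sumTo a′ (λ i → fromℕ (m i ℕ.^ (μ ∸ n)) * pow lam (m i)))
        + pow (- v) (suc μ) * eulerPoly μ lam
        ≈⟨ +-cong (sumTo-cong μ (λ n → *-congʳ (sym (coeff≈ μ n)))) (*-congʳ (pow-neg v (suc μ))) ⟩
      _ ∎

theorem1 : {c ℓ : Level} (K : CommutativeRing c ℓ) →
  let open CommutativeRing K
      open RingOps K
  in IsField → CharZero →
  (k : ℕ) → 2 ≤ k → (A : Vec ℕ k) → (∀ (i : Fin k) → 0 < lookup A i) → gcdVec A ≡ 1 →
  (m : ℕ → ℕ) → m 0 ≡ 0 →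
  (∀ i → 1 ≤ i → i < first A →
     0 < m i × (+ first A) ∣ℤ (+ m i ℤ.- + i) × InR A (m i) ×
     (∀ x → 0 < x → (+ first A) ∣ℤ (+ x ℤ.- + i) → InR A x → m i ≤ x)) →
  (NR : List ℕ) → Unique NR → (∀ n → (n ∈ NR) ⇔ InNR A n) →
  (lam : Carrier) → ¬ (lam ≈ 0#) → ¬ (pow lam (first A) ≈ 1#) →
  (u : Carrier) → u * (pow lam (first A) - 1#) ≈ 1# →
  (v : Carrier) → v * (lam - 1#) ≈ 1# →
  (μ : ℕ) → 1 ≤ μ →
  sumList NR (λ n → pow lam n * fromℕ (n ℕ.^ μ))
    ≈
  sumTo μ (λ n →
      pow (- fromℕ (first A)) n * pow u (suc n) * fromℕ (μ C n)
      * sumTo n (λ j → fromℕ (eulerian n (n ∸ j)) * pow lam (j ℕ.* first A))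
      * sumTo (first A ∸ 1) (λ i → fromℕ (m i ℕ.^ (μ ∸ n)) * pow lam (m i)))
  + pow (- 1#) (suc μ) * pow v (suc μ)
    * sumTo μ (λ j → fromℕ (eulerian μ (μ ∸ j)) * pow lam j)
theorem1 K _ _ _ _ (zero ∷ _) positive _ _ _ _ _ _ _ _ _ _ _ _ _ _ _ _ = ⊥-elim (ℕ.<-irrefl ≡.refl (positive Fin.zero))
theorem1 K _ _ _ _ (suc a′ ∷ A′) _ _ m m0≡0 apery NR NR-unique NR⇔ lam _ _ u hu v hv μ _ =
  NonRepresentablePowerSum.sumList-NR-powers K a′ lam u v hu hv A′ m m0≡0 apery NR NR-unique NR⇔ μ
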